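{- Let $p$ be an odd prime, $r,s\ge0$ integers with $r+s=g$, and let $\pi:J(\mathbb{Z}_p)\to GL_g(\mathbb{F}_{p^2})$ be entrywise reduction modulo $\Pi$, where $J(\mathbb{Z}_p)=\{X\in GL_g(\mathfrak{R}_p):\bar X^tX=c(X)I_g,\ c(X)\in\mathbb{Z}_p^\times,\ X\Phi=\Phi X\}$. Then the image of $\pi$ is exactly $G(p):=G(U_r\times U_s)(\mathbb{F}_{p^2})$; i.e. with $U_p:=\ker\pi$ there is a short exact sequence of groups $1\to U_p\to J(\mathbb{Z}_p)\xrightarrow{\pi}G(p)\to1$.
   Context: $k=\mathbb{Q}(\sqrt\alpha)$ is an imaginary quadratic field in which $p$ is inert. $\mathfrak{B}_p$ is the quaternion division algebra over $\mathbb{Q}_p$, with canonical involution $x\mapsto\bar x$, and $\mathfrak{R}_p$ its maximal order; $\varphi_\alpha\in\mathfrak{R}_p$ satisfies $\varphi_\alpha^2=\alpha$, and $\mathfrak{R}_p=\mathbb{Z}_p[\varphi_\alpha]\oplus\mathbb{Z}_p[\varphi_\alpha]\Pi$ with $\Pi$ a uniformizer, $\Pi^2=p$. The reduction map $\mathfrak{R}_p\to\mathfrak{R}_p/\Pi\mathfrak{R}_p\cong\mathbb{Z}_p[\varphi_\alpha]/(p)\cong\mathbb{F}_{p^2}$ sends $\varphi_\alpha\mapsto\sqrt\alpha\pmod p$. $\Phi=\mathrm{diag}(-\varphi_\alpha I_r,\varphi_\alpha I_s)$. $G(U_r\times U_s)(\mathbb{F}_{p^2})=\{\mathrm{diag}(X,Y):X\in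 GL_r(\mathbb{F}_{p^2}),Y\in GL_s(\mathbb{F}_{p^2}),\ X^*X=cI_r,\ Y^*Y=cI_s,\ c\in\mathbb{F}_p^\times\}$, $X^*$ denoting the transpose of the matrix obtained by applying the nontrivial automorphism of $\mathbb{F}_{p^2}$ to the entries. -}

module Defs where

open import Data.Nat as ℕ using (ℕ; zero; suc)
open import Data.Integer as ℤ using (ℤ; +_; _+_; _*_; -_; _-_)
open import Data.Integer.Divisibility using (_∣_)
open import Data.Fin using (Fin; zero; suc; splitAt)
open import Data.Product using (Σ; _×_; _,_)
open import Data.Sum using (inj₁; inj₂)
open import Relation.Nullary using (¬_)
open import Relation.Binary.PropositionalEquality using (_≡_)

Cong : ℕ → ℤ → ℤ → Set
Cong m a b = (+ m) ∣ (a - b)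

-- ℤ[φ] with φ² = α :  x0 + x1 φ.
-- Its completion at p is ℤ_p[φ_α]; its reduction mod p is 𝔽_{p²}
-- (for α a non-residue mod p) with φ ↦ √α.

record Zφ : Set where
  constructor _+φ_
  field
    c0 c1 : ℤ
open Zφ public

module _ (α : ℤ) where
  addφ : Zφ → Zφ → Zφ
  addφ (x0 +φ x1) (y0 +φ y1) = (x0 + y0) +φ (x1 + y1)

  mulφ : Zφ → Zφ → Zφ
  mulφ (x0 +φ x1) (y0 +φ y1) = (x0 * y0 + α * (x1 * y1)) +φ (x0 * y1 + x1 * y0)

-- Galois conjugation φ ↦ -φ (on 𝔽_{p²}: the Frobenius / nontrivial automorphism)
conjφ : Zφ → Zφ
conjφ (x0 +φ x1) = x0 +φ (- x1)

zeroφ oneφ : Zφ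
zeroφ = (+ 0) +φ (+ 0)
oneφ  = (+ 1) +φ (+ 0)

scalφ : ℤ → Zφ
scalφ c = c +φ (+ 0)

CongZφ : ℕ → Zφ → Zφ → Set
CongZφ m x y = Cong m (c0 x) (c0 y) × Cong m (c1 x) (c1 y)

-- The order ℤ[φ] ⊕ ℤ[φ]Π with Πa = ā Π, Π² = p.
-- Its p-adic completion is 𝔑_p = ℤ_p[φ_α] ⊕ ℤ_p[φ_α] Π.

record Quat : Set where
  constructor _+Π_
  field
    qa qb : Zφ
open Quat public

module _ (p : ℕ) (α : ℤ) where
  addQ : Quat → Quat → Quat
  addQ (a +Π b) (c +Π d) = addφ α a c +Π addφ α b d

  -- (a + bΠ)(c + dΠ) = (ac + p b d̄) + (ad + b c̄)Π
  mulQ : Quat → Quat → Quat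
  mulQ (a +Π b) (c +Π d) =
    addφ α (mulφ α a c) (mulφ α (scalφ (+ p)) (mulφ α b (conjφ d)))
    +Π addφ α (mulφ α a d) (mulφ α b (conjφ c))

conjQ : Quat → Quat
conjQ (a +Π (b0 +φ b1)) = conjφ a +Π ((- b0) +φ (- b1))

zeroQ oneQ : Quat
zeroQ = zeroφ +Π zeroφ
oneQ  = oneφ  +Π zeroφ

scalQ : ℤ → Quat
scalQ c = scalφ c +Π zeroφ

φQ : Quat
φQ = ((+ 0) +φ (+ 1)) +Π zeroφ

negφQ : Quat
negφQ = ((+ 0) +φ (- (+ 1))) +Π zeroφ

CongQ : ℕ → Quat → Quat → Set
CongQ m x y = CongZφ m (qa x) (qa y) × CongZφ m (qb x) (qb y)

Mat : ℕ → Set → Set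
Mat n A = Fin n → Fin n → A

sumFin : {A : Set} → (A → A → A) → A → {n : ℕ} → (Fin n → A) → A
sumFin _⊕_ z {zero}  f = z
sumFin _⊕_ z {suc n} f = f zero ⊕ sumFin _⊕_ z (λ i → f (suc i))

matMul : {A : Set} → (A → A → A) → (A → A → A) → A → {n : ℕ} → Mat n A → Mat n A → Mat n A
matMul _⊕_ _⊗_ z X Y i j = sumFin _⊕_ z (λ k → X i k ⊗ Y k j)

conjT : {A : Set} → (A → A) → {n : ℕ} → Mat n A → Mat n A
conjT cj X i j = cj (X j i)

diagM : {A : Set} → A → A → {n : ℕ} → (Fin n → A) → Mat n A
diagM z _ {zero} d ()
diagM z _ {suc n} d zero zero = d zero
diagM z _ {suc n} d zero (suc j) = z
diagM z _ {suc n} d (suc i) zero = z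
diagM z o {suc n} d (suc i) (suc j) = diagM z o (λ k → d (suc k)) i j

scalarMat : {A : Set} → A → A → {n : ℕ} → Mat n A
scalarMat z c = diagM z c (λ _ → c)

blockDiag : {A : Set} → A → (r s : ℕ) → Mat r A → Mat s A → Mat (r ℕ.+ s) A
blockDiag z r s X Y i j with splitAt r i | splitAt r j
... | inj₁ a | inj₁ b = X a b
... | inj₂ a | inj₂ b = Y a b
... | inj₁ _ | inj₂ _ = z
... | inj₂ _ | inj₁ _ = z

MatCong : {A : Set} → (ℕ → A → A → Set) → ℕ → {n : ℕ} → Mat n A → Mat n A → Set
MatCong C m X Y = ∀ i j → C m (X i j) (Y i j)

-- ℤ_p-points as compatible systems of approximations:
-- an element of a p-adic completion is a sequence x : ℕ → A with
-- x (n+1) ≡ x n (mod p^n); two are equal iff x n ≡ y n (mod p^n) for all n.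

Coherent : {A : Set} → (ℕ → A → A → Set) → ℕ → (ℕ → A) → Set
Coherent C p x = ∀ n → C (p ℕ.^ n) (x (suc n)) (x n)

IsUnitZp : ℕ → (ℕ → ℤ) → Set
IsUnitZp p c = Σ (ℕ → ℤ) λ d → Coherent Cong p d × (∀ n → Cong (p ℕ.^ n) (c n * d n) (+ 1))

module _ (p : ℕ) (α : ℤ) where
  QMul : {n : ℕ} → Mat n Quat → Mat n Quat → Mat n Quat
  QMul = matMul (addQ p α) (mulQ p α) zeroQ

  QI : {n : ℕ} → Mat n Quat
  QI = scalarMat zeroQ oneQ

  Φ : (r s : ℕ) → Mat (r ℕ.+ s) Quat
  Φ r s = blockDiag zeroQ r s (scalarMat zeroQ negφQ) (scalarMat zeroQ φQ)

  MatRp : (g : ℕ) → (ℕ → Mat g Quat) → Set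
  MatRp g X = Coherent (λ m (A B : Mat g Quat) → MatCong CongQ m A B) p X

  InGLRp : (g : ℕ) → (ℕ → Mat g Quat) → Set
  InGLRp g X = MatRp g X × Σ (ℕ → Mat g Quat) λ Y → MatRp g Y
      × (∀ n → MatCong CongQ (p ℕ.^ n) (QMul (X n) (Y n)) QI)
      × (∀ n → MatCong CongQ (p ℕ.^ n) (QMul (Y n) (X n)) QI)

  InJ : (r s : ℕ) → (ℕ → Mat (r ℕ.+ s) Quat) → Set
  InJ r s X = InGLRp (r ℕ.+ s) X
    × (Σ (ℕ → ℤ) λ c → Coherent Cong p c × IsUnitZp p c
         × (∀ n → MatCong CongQ (p ℕ.^ n) (QMul (conjT conjQ (X n)) (X n)) (scalarMat zeroQ (scalQ (c n)))))
    × (∀ n → MatCong CongQ (p ℕ.^ n) (QMul (X n) (Φ r s)) (QMul (Φ r s) (X n)))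

  -- 𝔽_{p²} = ℤ[φ]/(p), matrices over it (equality is congruence mod p)
  FMul : {n : ℕ} → Mat n Zφ → Mat n Zφ → Mat n Zφ
  FMul = matMul (addφ α) (mulφ α) zeroφ

  FI : {n : ℕ} → Mat n Zφ
  FI = scalarMat zeroφ oneφ

  InGLF : (n : ℕ) → Mat n Zφ → Set
  InGLF n X = Σ (Mat n Zφ) λ Y → MatCong CongZφ p (FMul X Y) FI × MatCong CongZφ p (FMul Y X) FI

  InG : (r s : ℕ) → Mat (r ℕ.+ s) Zφ → Set
  InG r s M = Σ (Mat r Zφ) λ X → Σ (Mat s Zφ) λ Y → Σ ℤ λ c →
      InGLF r X × InGLF s Y × ¬ ((+ p) ∣ c)
    × MatCong CongZφ p (FMul (conjT conjφ X) X) (scalarMat zeroφ (scalφ c))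
    × MatCong CongZφ p (FMul (conjT conjφ Y) Y) (scalarMat zeroφ (scalφ c))
    × MatCong CongZφ p M (blockDiag zeroφ r s X Y)

-- π : entrywise reduction modulo Π, 𝔑_p → 𝔑_p/Π𝔑_p ≅ ℤ_p[φ_α]/(p) ≅ 𝔽_{p²}
-- (read off the level-1 approximation, i.e. modulo p, and drop the Π-part)
π : {g : ℕ} → (ℕ → Mat g Quat) → Mat g Zφ
π X i j = qa (X 1 i j)

module Submission where

-- Image: for X ∈ J(ℤ_p), π X commutes with diag(-φ, φ) mod p,
-- which forces it to be block diagonal because φ ≢ -φ; its blocks inherit
-- invertibility and c-unitarity.  Surjectivity: lift each block of an element
-- of G(p) by Hensel's lemma and embed the block-diagonal lift in ℜ.

open import Level using (0ℓ)
open import Algebra.Bundles using (CommutativeRing)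
open import Data.Integer using (ℤ; +_)
open import Data.Nat using (ℕ)
open import Data.Nat.Primality using (Prime)
open import Data.Integer.Divisibility using (_∣_)
open import Relation.Nullary using (¬_)
open import Relation.Binary.PropositionalEquality using (_≢_)

module IntegerCongruence where

  open import Defs using (Cong)
  open import Data.Nat as ℕ using (ℕ)
  import Data.Nat.Divisibility as ℕD
  open import Data.Integer using (ℤ; _+_; _*_; -_; _-_)
  import Data.Integer.Properties as ℤP
  open import Data.Integer.Divisibility.Signed
    using (divides; ∣ᵤ⇒∣; ∣⇒∣ᵤ; ∣-trans; ∣m⇒∣-m; ∣m∣n⇒∣m+n; ∣m⇒∣m*n; ∣n⇒∣m*n) renaming (_∣_ to _∣ˢ_)
  open import Data.Integer.Tactic.RingSolver using (solve-∀)
  open import Relation.Binary.PropositionalEquality using (_≡_; refl; sym; trans; cong; cong₂; subst)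

  -- `ModEq m a b` says a ≡ b (mod m).  It is a record around the (signed)
  -- divisibility m ∣ a - b so that a and b stay visible to unification.
  record ModEq (m : ℕ) (a b : ℤ) : Set where
    constructor modEq
    field divides-diff : + m ∣ˢ a - b
  open ModEq public

  toCong : ∀ {m a b} → ModEq m a b → Cong m a b
  toCong h = ∣⇒∣ᵤ (divides-diff h)

  fromCong : ∀ {m a b} → Cong m a b → ModEq m a b
  fromCong h = modEq (∣ᵤ⇒∣ h)

  ∣⇒≡0 : ∀ {m a} → (+ m) ∣ a → ModEq m a (+ 0)
  ∣⇒≡0 {a = a} h = modEq (∣ᵤ⇒∣ (subst ((+ _) ∣_) (sym (ℤP.+-identityʳ a)) h))

  modEq⇒∣ : ∀ {m a b z} → ModEq m a b → a - b ≡ z → (+ m) ∣ z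
  modEq⇒∣ h e = subst ((+ _) ∣_) e (toCong h)

  modEq-via : ∀ {m x} a b → x ≡ a - b → + m ∣ˢ x → ModEq m a b
  modEq-via a b e d = modEq (subst (_ ∣ˢ_) e d)

  modEq-reflexive : ∀ {m a b} → a ≡ b → ModEq m a b
  modEq-reflexive {m} {a} refl =
    modEq-via a a (sym (ℤP.+-inverseʳ a)) (divides (+ 0) (sym (ℤP.*-zeroˡ (+ m))))

  modEq-refl : ∀ {m a} → ModEq m a a
  modEq-refl = modEq-reflexive refl

  modEq-sym : ∀ {m a b} → ModEq m a b → ModEq m b a
  modEq-sym {a = a} {b} (modEq d) = modEq-via b a (lem a b) (∣m⇒∣-m d)
    where lem : ∀ a b → - (a - b) ≡ b - a
          lem = solve-∀

  modEq-trans : ∀ {m a b c} → ModEq m a b → ModEq m b c → ModEq m a c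
  modEq-trans {a = a} {b} {c} (modEq d) (modEq d′) = modEq-via a c (lem a b c) (∣m∣n⇒∣m+n d d′)
    where lem : ∀ a b c → (a - b) + (b - c) ≡ a - c
          lem = solve-∀

  modEq-+ : ∀ {m a b c d} → ModEq m a b → ModEq m c d → ModEq m (a + c) (b + d)
  modEq-+ {a = a} {b} {c} {d} (modEq h) (modEq k) = modEq-via (a + c) (b + d) (lem a b c d) (∣m∣n⇒∣m+n h k)
    where lem : ∀ a b c d → (a - b) + (c - d) ≡ (a + c) - (b + d)
          lem = solve-∀

  modEq-neg : ∀ {m a b} → ModEq m a b → ModEq m (- a) (- b)
  modEq-neg {a = a} {b} (modEq h) = modEq-via (- a) (- b) (lem a b) (∣m⇒∣-m h)
    where lem : ∀ a b → - (a - b) ≡ (- a) - (- b)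
          lem = solve-∀

  modEq-* : ∀ {m a b c d} → ModEq m a b → ModEq m c d → ModEq m (a * c) (b * d)
  modEq-* {a = a} {b} {c} {d} (modEq h) (modEq k) =
    modEq-via (a * c) (b * d) (lem a b c d) (∣m∣n⇒∣m+n (∣m⇒∣m*n c h) (∣n⇒∣m*n b k))
    where lem : ∀ a b c d → (a - b) * c + b * (c - d) ≡ a * c - b * d
          lem = solve-∀

  modEq-weaken : ∀ {m n a b} → m ℕD.∣ n → ModEq n a b → ModEq m a b
  modEq-weaken m∣n (modEq h) = modEq (∣-trans (∣ᵤ⇒∣ m∣n) h)

  modEq-zero-* : ∀ {m n a b} → ModEq m a (+ 0) → ModEq n b (+ 0) → ModEq (m ℕ.* n) (a * b) (+ 0)
  modEq-zero-* {m} {n} {a} {b} (modEq (divides q eq)) (modEq (divides r eq′)) =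
    modEq-via {x = a * b} (a * b) (+ 0) (sym (ℤP.+-identityʳ (a * b)))
      (divides (q * r) (trans (cong₂ _*_ (minus-zero a eq) (minus-zero b eq′))
                         (trans (lem q (+ m) r (+ n)) (cong ((q * r) *_) (sym (ℤP.pos-* m n))))))
    where
    minus-zero : ∀ z {x} → z - + 0 ≡ x → z ≡ x
    minus-zero z e = trans (sym (ℤP.+-identityʳ z)) e
    lem : ∀ q m r n → (q * m) * (r * n) ≡ (q * r) * (m * n)
    lem = solve-∀


module QuadraticOrder where

  open import Defs
  open IntegerCongruence
  open import Data.Nat as ℕ using (ℕ)
  import Data.Nat.Divisibility as ℕD
  open import Data.Integer using (ℤ; +_; _+_; _*_; -_; _-_)
  import Data.Integer.Properties as ℤP
  open import Data.Integer.Tactic.RingSolver using (solve-∀)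
  open import Data.Product using (_,_)
  open import Relation.Binary.PropositionalEquality using (_≡_; refl; trans; cong₂)

  negφ : Zφ → Zφ
  negφ (x0 +φ x1) = (- x0) +φ (- x1)

  module OrderLaws (α : ℤ) where
    private
      _⊕_ = addφ α
      _⊗_ = mulφ α

    ⊕-assoc : ∀ x y z → (x ⊕ y) ⊕ z ≡ x ⊕ (y ⊕ z)
    ⊕-assoc x y z = cong₂ _+φ_ (ℤP.+-assoc (c0 x) _ _) (ℤP.+-assoc (c1 x) _ _)
    ⊕-comm : ∀ x y → x ⊕ y ≡ y ⊕ x
    ⊕-comm x y = cong₂ _+φ_ (ℤP.+-comm (c0 x) _) (ℤP.+-comm (c1 x) _)
    ⊕-identityˡ : ∀ x → zeroφ ⊕ x ≡ x
    ⊕-identityˡ x = cong₂ _+φ_ (ℤP.+-identityˡ (c0 x)) (ℤP.+-identityˡ (c1 x))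
    ⊕-identityʳ : ∀ x → x ⊕ zeroφ ≡ x
    ⊕-identityʳ x = cong₂ _+φ_ (ℤP.+-identityʳ (c0 x)) (ℤP.+-identityʳ (c1 x))
    ⊕-inverseˡ : ∀ x → negφ x ⊕ x ≡ zeroφ
    ⊕-inverseˡ x = cong₂ _+φ_ (ℤP.+-inverseˡ (c0 x)) (ℤP.+-inverseˡ (c1 x))
    ⊕-inverseʳ : ∀ x → x ⊕ negφ x ≡ zeroφ
    ⊕-inverseʳ x = cong₂ _+φ_ (ℤP.+-inverseʳ (c0 x)) (ℤP.+-inverseʳ (c1 x))

    ⊗-assoc : ∀ x y z → (x ⊗ y) ⊗ z ≡ x ⊗ (y ⊗ z)
    ⊗-assoc (x0 +φ x1) (y0 +φ y1) (z0 +φ z1) =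
      cong₂ _+φ_ (l0 α x0 x1 y0 y1 z0 z1) (l1 α x0 x1 y0 y1 z0 z1)
      where
      l0 : ∀ a x0 x1 y0 y1 z0 z1 → (x0 * y0 + a * (x1 * y1)) * z0 + a * ((x0 * y1 + x1 * y0) * z1)
                                 ≡ x0 * (y0 * z0 + a * (y1 * z1)) + a * (x1 * (y0 * z1 + y1 * z0))
      l0 = solve-∀
      l1 : ∀ a x0 x1 y0 y1 z0 z1 → (x0 * y0 + a * (x1 * y1)) * z1 + (x0 * y1 + x1 * y0) * z0
                                 ≡ x0 * (y0 * z1 + y1 * z0) + x1 * (y0 * z0 + a * (y1 * z1))
      l1 = solve-∀
    ⊗-comm : ∀ x y → x ⊗ y ≡ y ⊗ x
    ⊗-comm (x0 +φ x1) (y0 +φ y1) = cong₂ _+φ_ (l0 α x0 x1 y0 y1) (l1 x0 x1 y0 y1)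
      where
      l0 : ∀ a x0 x1 y0 y1 → x0 * y0 + a * (x1 * y1) ≡ y0 * x0 + a * (y1 * x1)
      l0 = solve-∀
      l1 : ∀ x0 x1 y0 y1 → x0 * y1 + x1 * y0 ≡ y0 * x1 + y1 * x0
      l1 = solve-∀
    ⊗-identityˡ : ∀ x → oneφ ⊗ x ≡ x
    ⊗-identityˡ (x0 +φ x1) = cong₂ _+φ_ (l0 α x0 x1) (l1 x0 x1)
      where
      l0 : ∀ a x0 x1 → + 1 * x0 + a * (+ 0 * x1) ≡ x0
      l0 = solve-∀
      l1 : ∀ x0 x1 → + 1 * x1 + + 0 * x0 ≡ x1
      l1 = solve-∀
    ⊗-identityʳ : ∀ x → x ⊗ oneφ ≡ x
    ⊗-identityʳ x = trans (⊗-comm x oneφ) (⊗-identityˡ x)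
    ⊗-distribˡ : ∀ x y z → x ⊗ (y ⊕ z) ≡ (x ⊗ y) ⊕ (x ⊗ z)
    ⊗-distribˡ (x0 +φ x1) (y0 +φ y1) (z0 +φ z1) =
      cong₂ _+φ_ (l0 α x0 x1 y0 y1 z0 z1) (l1 x0 x1 y0 y1 z0 z1)
      where
      l0 : ∀ a x0 x1 y0 y1 z0 z1 → x0 * (y0 + z0) + a * (x1 * (y1 + z1))
                                 ≡ (x0 * y0 + a * (x1 * y1)) + (x0 * z0 + a * (x1 * z1))
      l0 = solve-∀
      l1 : ∀ x0 x1 y0 y1 z0 z1 → x0 * (y1 + z1) + x1 * (y0 + z0) ≡ (x0 * y1 + x1 * y0) + (x0 * z1 + x1 * z0)
      l1 = solve-∀
    ⊗-distribʳ : ∀ x y z → (y ⊕ z) ⊗ x ≡ (y ⊗ x) ⊕ (z ⊗ x)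
    ⊗-distribʳ x y z = trans (⊗-comm (y ⊕ z) x) (trans (⊗-distribˡ x y z) (cong₂ _⊕_ (⊗-comm x y) (⊗-comm x z)))

    conj-⊕ : ∀ x y → conjφ (x ⊕ y) ≡ conjφ x ⊕ conjφ y
    conj-⊕ x y = cong₂ _+φ_ refl (ℤP.neg-distrib-+ (c1 x) (c1 y))
    conj-⊗ : ∀ x y → conjφ (x ⊗ y) ≡ conjφ x ⊗ conjφ y
    conj-⊗ (x0 +φ x1) (y0 +φ y1) = cong₂ _+φ_ (l0 α x0 x1 y0 y1) (l1 x0 x1 y0 y1)
      where
      l0 : ∀ a x0 x1 y0 y1 → x0 * y0 + a * (x1 * y1) ≡ x0 * y0 + a * ((- x1) * (- y1))
      l0 = solve-∀
      l1 : ∀ x0 x1 y0 y1 → - (x0 * y1 + x1 * y0) ≡ x0 * (- y1) + (- x1) * y0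
      l1 = solve-∀
    conj-involutive : ∀ x → conjφ (conjφ x) ≡ x
    conj-involutive x = cong₂ _+φ_ refl (ℤP.neg-involutive (c1 x))

  record ModEqφ (m : ℕ) (x y : Zφ) : Set where
    constructor _,φ_
    field
      c0-modEq : ModEq m (c0 x) (c0 y)
      c1-modEq : ModEq m (c1 x) (c1 y)
  open ModEqφ public

  toCongZφ : ∀ {m x y} → ModEqφ m x y → CongZφ m x y
  toCongZφ (h0 ,φ h1) = toCong h0 , toCong h1

  fromCongZφ : ∀ {m x y} → CongZφ m x y → ModEqφ m x y
  fromCongZφ (h0 , h1) = fromCong h0 ,φ fromCong h1

  module _ {m : ℕ} where
    modEqφ-reflexive : ∀ {x y} → x ≡ y → ModEqφ m x y
    modEqφ-reflexive refl = modEq-refl ,φ modEq-refl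
    modEqφ-sym : ∀ {x y} → ModEqφ m x y → ModEqφ m y x
    modEqφ-sym (a ,φ b) = modEq-sym a ,φ modEq-sym b
    modEqφ-trans : ∀ {x y z} → ModEqφ m x y → ModEqφ m y z → ModEqφ m x z
    modEqφ-trans (a ,φ b) (c ,φ d) = modEq-trans a c ,φ modEq-trans b d

    module _ (α : ℤ) where
      addφ-cong : ∀ {x y u v} → ModEqφ m x y → ModEqφ m u v → ModEqφ m (addφ α x u) (addφ α y v)
      addφ-cong (a ,φ b) (c ,φ d) = modEq-+ a c ,φ modEq-+ b d
      negφ-cong : ∀ {x y} → ModEqφ m x y → ModEqφ m (negφ x) (negφ y)
      negφ-cong (a ,φ b) = modEq-neg a ,φ modEq-neg b
      mulφ-cong : ∀ {x y u v} → ModEqφ m x y → ModEqφ m u v → ModEqφ m (mulφ α x u) (mulφ α y v)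
      mulφ-cong (a ,φ b) (c ,φ d) =
        modEq-+ (modEq-* a c) (modEq-* (modEq-refl {a = α}) (modEq-* b d)) ,φ modEq-+ (modEq-* a d) (modEq-* b c)

    conjφ-cong : ∀ {x y} → ModEqφ m x y → ModEqφ m (conjφ x) (conjφ y)
    conjφ-cong (a ,φ b) = a ,φ modEq-neg b

  ResidueRing : ℤ → ℕ → CommutativeRing 0ℓ 0ℓ
  ResidueRing α m = record
    { Carrier = Zφ ; _≈_ = ModEqφ m ; _+_ = addφ α ; _*_ = mulφ α ; -_ = negφ ; 0# = zeroφ ; 1# = oneφ
    ; isCommutativeRing = record
      { isRing = record
        { +-isAbelianGroup = record
          { isGroup = record
            { isMonoid = record
              { isSemigroup = record
                { isMagma = record
                  { isEquivalence = record
                    { refl = modEqφ-reflexive refl ; sym = modEqφ-sym ; trans = modEqφ-trans }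
                  ; ∙-cong = addφ-cong α }
                ; assoc = λ x y z → ≡⇒ (⊕-assoc x y z) }
              ; identity = (λ x → ≡⇒ (⊕-identityˡ x)) , (λ x → ≡⇒ (⊕-identityʳ x)) }
            ; inverse = (λ x → ≡⇒ (⊕-inverseˡ x)) , (λ x → ≡⇒ (⊕-inverseʳ x))
            ; ⁻¹-cong = negφ-cong α }
          ; comm = λ x y → ≡⇒ (⊕-comm x y) }
        ; *-cong = mulφ-cong α
        ; *-assoc = λ x y z → ≡⇒ (⊗-assoc x y z)
        ; *-identity = (λ x → ≡⇒ (⊗-identityˡ x)) , (λ x → ≡⇒ (⊗-identityʳ x))
        ; distrib = (λ x y z → ≡⇒ (⊗-distribˡ x y z)) , (λ x y z → ≡⇒ (⊗-distribʳ x y z)) }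
      ; *-comm = λ x y → ≡⇒ (⊗-comm x y) } }
    where
    open OrderLaws α
    ≡⇒ : ∀ {x y} → x ≡ y → ModEqφ m x y
    ≡⇒ = modEqφ-reflexive

  modEqφ-weaken : ∀ {a b x y} → a ℕD.∣ b → ModEqφ b x y → ModEqφ a x y
  modEqφ-weaken d (h0 ,φ h1) = modEq-weaken d h0 ,φ modEq-weaken d h1

  module Multiplicative (α : ℤ) where
    modEqφ-zero-* : ∀ {a b x y} → ModEqφ a x zeroφ → ModEqφ b y zeroφ → ModEqφ (a ℕ.* b) (mulφ α x y) zeroφ
    modEqφ-zero-* (h0 ,φ h1) (k0 ,φ k1) =
      modEq-+ (modEq-zero-* h0 k0) (modEq-trans (modEq-* (modEq-refl {a = α}) (modEq-zero-* h1 k1)) (modEq-reflexive (ℤP.*-zeroʳ α)))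
      ,φ modEq-+ (modEq-zero-* h0 k1) (modEq-zero-* h1 k0)

    modEqφ-unit-* : ∀ {a b t x} → ModEqφ a t oneφ → ModEqφ b x zeroφ → ModEqφ (a ℕ.* b) (mulφ α t x) x
    modEqφ-unit-* {t = t} {x} (h0 ,φ h1) k =
      modEqφ-trans (modEqφ-reflexive split)
        (modEqφ-trans (addφ-cong α (modEqφ-zero-* (modEq-+ h0 (modEq-refl {a = - (+ 1)}) ,φ modEq-+ h1 modEq-refl) k)
                                   (modEqφ-reflexive refl))
                      (modEqφ-reflexive (OrderLaws.⊕-identityˡ α x)))
      where
      split : mulφ α t x ≡ addφ α (mulφ α (addφ α t (negφ oneφ)) x) x
      split = cong₂ _+φ_ (l0 α (c0 t) (c1 t) (c0 x) (c1 x)) (l1 (c0 t) (c1 t) (c0 x) (c1 x))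
        where
        l0 : ∀ a t0 t1 x0 x1 → t0 * x0 + a * (t1 * x1) ≡ ((t0 + - (+ 1)) * x0 + a * ((t1 + - (+ 0)) * x1)) + x0
        l0 = solve-∀
        l1 : ∀ t0 t1 x0 x1 → t0 * x1 + t1 * x0 ≡ ((t0 + - (+ 1)) * x1 + (t1 + - (+ 0)) * x0) + x1
        l1 = solve-∀


module MatrixShapes where

  open import Defs
  open import Data.Nat as ℕ using (ℕ; zero; suc)
  open import Data.Fin using (Fin; zero; suc; _↑ˡ_; _↑ʳ_; splitAt)
  open import Data.Fin.Properties using (splitAt-↑ˡ; splitAt-↑ʳ; suc-injective)
  open import Data.Sum using (inj₁; inj₂)
  open import Data.Empty using (⊥-elim)
  open import Relation.Binary.PropositionalEquality using (_≡_; _≢_; refl; cong)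

  module _ {A : Set} where
    diagM-diag : ∀ (z o : A) {n} (d : Fin n → A) i → diagM z o d i i ≡ d i
    diagM-diag z o d zero = refl
    diagM-diag z o d (suc i) = diagM-diag z o (λ k → d (suc k)) i

    diagM-off : ∀ (z o : A) {n} (d : Fin n → A) i j → i ≢ j → diagM z o d i j ≡ z
    diagM-off z o d zero zero ne = ⊥-elim (ne refl)
    diagM-off z o d zero (suc j) ne = refl
    diagM-off z o d (suc i) zero ne = refl
    diagM-off z o d (suc i) (suc j) ne = diagM-off z o (λ k → d (suc k)) i j (λ e → ne (cong suc e))

    diagM-map : ∀ {B : Set} (f : A → B) (z o : A) {n} (d : Fin n → A) i j
      → f (diagM z o d i j) ≡ diagM (f z) (f o) (λ k → f (d k)) i j
    diagM-map f z o d zero zero = refl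
    diagM-map f z o d zero (suc j) = refl
    diagM-map f z o d (suc i) zero = refl
    diagM-map f z o d (suc i) (suc j) = diagM-map f z o (λ k → d (suc k)) i j

    module _ (z : A) (r s : ℕ) (X : Mat r A) (Y : Mat s A) where
      blockDiag-ll : ∀ a b → blockDiag z r s X Y (a ↑ˡ s) (b ↑ˡ s) ≡ X a b
      blockDiag-ll a b rewrite splitAt-↑ˡ r a s | splitAt-↑ˡ r b s = refl
      blockDiag-lr : ∀ a b → blockDiag z r s X Y (a ↑ˡ s) (r ↑ʳ b) ≡ z
      blockDiag-lr a b rewrite splitAt-↑ˡ r a s | splitAt-↑ʳ r s b = refl
      blockDiag-rl : ∀ a b → blockDiag z r s X Y (r ↑ʳ a) (b ↑ˡ s) ≡ z
      blockDiag-rl a b rewrite splitAt-↑ʳ r s a | splitAt-↑ˡ r b s = refl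
      blockDiag-rr : ∀ a b → blockDiag z r s X Y (r ↑ʳ a) (r ↑ʳ b) ≡ Y a b
      blockDiag-rr a b rewrite splitAt-↑ʳ r s a | splitAt-↑ʳ r s b = refl

  blockDiag-map : ∀ {A B : Set} (f : A → B) (z : A) r s (X : Mat r A) (Y : Mat s A) i j
    → f (blockDiag z r s X Y i j) ≡ blockDiag (f z) r s (λ a b → f (X a b)) (λ a b → f (Y a b)) i j
  blockDiag-map f z r s X Y i j with splitAt r i | splitAt r j
  ... | inj₁ a | inj₁ b = refl
  ... | inj₁ a | inj₂ b = refl
  ... | inj₂ a | inj₁ b = refl
  ... | inj₂ a | inj₂ b = refl

  blockDiag-conjT : ∀ {A : Set} (cj : A → A) (z : A) r s (X : Mat r A) (Y : Mat s A) i j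
    → conjT cj (blockDiag z r s X Y) i j ≡ blockDiag (cj z) r s (conjT cj X) (conjT cj Y) i j
  blockDiag-conjT cj z r s X Y i j with splitAt r i | splitAt r j
  ... | inj₁ a | inj₁ b = refl
  ... | inj₁ a | inj₂ b = refl
  ... | inj₂ a | inj₁ b = refl
  ... | inj₂ a | inj₂ b = refl

  blockDiag-ext : ∀ {A : Set} (z : A) r s {X X′ : Mat r A} {Y Y′ : Mat s A}
    → (∀ a b → X a b ≡ X′ a b) → (∀ a b → Y a b ≡ Y′ a b) → ∀ i j
    → blockDiag z r s X Y i j ≡ blockDiag z r s X′ Y′ i j
  blockDiag-ext z r s hX hY i j with splitAt r i | splitAt r j
  ... | inj₁ a | inj₁ b = hX a b
  ... | inj₁ a | inj₂ b = refl
  ... | inj₂ a | inj₁ b = refl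
  ... | inj₂ a | inj₂ b = hY a b

  data BlockView (r s : ℕ) : Fin (r ℕ.+ s) → Set where
    left  : (a : Fin r) → BlockView r s (a ↑ˡ s)
    right : (b : Fin s) → BlockView r s (r ↑ʳ b)

  blockView : ∀ r s (i : Fin (r ℕ.+ s)) → BlockView r s i
  blockView zero s i = right i
  blockView (suc r) s zero = left zero
  blockView (suc r) s (suc i) with blockView r s i
  ... | left a = left (suc a)
  ... | right b = right b

  ↑ˡ≢↑ʳ : ∀ {r s} (a : Fin r) (b : Fin s) → a ↑ˡ s ≢ r ↑ʳ b
  ↑ˡ≢↑ʳ {suc r} zero b ()
  ↑ˡ≢↑ʳ {suc r} (suc a) b e = ↑ˡ≢↑ʳ a b (suc-injective e)


module Matrices (R : CommutativeRing 0ℓ 0ℓ) where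

  open import Defs
  open import Data.Nat as ℕ using (ℕ; zero; suc)
  open import Data.Fin as Fin using (Fin; zero; suc; _↑ˡ_; _↑ʳ_)
  open import Data.Fin.Properties using (suc-injective; ↑ˡ-injective; ↑ʳ-injective)
  open import Relation.Nullary using (yes; no)
  open import Relation.Binary.Bundles using (Setoid)
  open import Relation.Binary.PropositionalEquality as P using (_≡_; _≢_)

  open CommutativeRing R renaming (Carrier to C) hiding (zero)
  open import Algebra.Properties.Ring ring using (-‿distribˡ-*; -‿distribʳ-*)
  open import Algebra.Properties.AbelianGroup +-abelianGroup using (⁻¹-∙-comm)
  open import Algebra.Properties.Group +-group using (⁻¹-involutive; ε⁻¹≈ε)
  open import Relation.Binary.Reasoning.Setoid setoid
  open MatrixShapes

  infixl 7 _·_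
  infixr 8 _⋆_
  infixl 6 _⊞_ _⊟_
  infix 4 _≋_

  _·_ : ∀ {n} → Mat n C → Mat n C → Mat n C
  _·_ = matMul _+_ _*_ 0#

  _≋_ : ∀ {n} → Mat n C → Mat n C → Set
  X ≋ Y = ∀ i j → X i j ≈ Y i j

  _⊞_ : ∀ {n} → Mat n C → Mat n C → Mat n C
  (X ⊞ Y) i j = X i j + Y i j

  ⊖ : ∀ {n} → Mat n C → Mat n C
  ⊖ X i j = - X i j

  _⊟_ : ∀ {n} → Mat n C → Mat n C → Mat n C
  X ⊟ Y = X ⊞ ⊖ Y

  _⋆_ : ∀ {n} → C → Mat n C → Mat n C
  (s ⋆ X) i j = s * X i j

  sc : ∀ {n} → C → Mat n C
  sc s = scalarMat 0# s

  I O : ∀ {n} → Mat n C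
  I = sc 1#
  O i j = 0#

  ≋-refl : ∀ {n} {X : Mat n C} → X ≋ X
  ≋-refl i j = refl
  ≋-sym : ∀ {n} {X Y : Mat n C} → X ≋ Y → Y ≋ X
  ≋-sym h i j = sym (h i j)
  ≋-trans : ∀ {n} {X Y Z : Mat n C} → X ≋ Y → Y ≋ Z → X ≋ Z
  ≋-trans h k i j = trans (h i j) (k i j)

  matSetoid : ℕ → Setoid 0ℓ 0ℓ
  matSetoid n = record
    { Carrier = Mat n C ; _≈_ = _≋_
    ; isEquivalence = record { refl = ≋-refl ; sym = ≋-sym ; trans = ≋-trans } }

  ≡⇒≈ : ∀ {x y} → x ≡ y → x ≈ y
  ≡⇒≈ P.refl = refl

  Σ : ∀ {n} → (Fin n → C) → C
  Σ = sumFin _+_ 0#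

  Σ-cong : ∀ {n} {f g : Fin n → C} → (∀ k → f k ≈ g k) → Σ f ≈ Σ g
  Σ-cong {zero} h = refl
  Σ-cong {suc n} h = +-cong (h zero) (Σ-cong (λ k → h (suc k)))

  Σ-zero : ∀ {n} {f : Fin n → C} → (∀ k → f k ≈ 0#) → Σ f ≈ 0#
  Σ-zero {zero} h = refl
  Σ-zero {suc n} h = trans (+-cong (h zero) (Σ-zero (λ k → h (suc k)))) (+-identityˡ 0#)

  Σ-+ : ∀ {n} (f g : Fin n → C) → Σ (λ k → f k + g k) ≈ Σ f + Σ g
  Σ-+ {zero} f g = sym (+-identityˡ 0#)
  Σ-+ {suc n} f g = trans (+-congˡ (Σ-+ (λ k → f (suc k)) (λ k → g (suc k)))) (+-interchange (f zero) (g zero) _ _)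
    where
    +-interchange : ∀ a b c d → (a + b) + (c + d) ≈ (a + c) + (b + d)
    +-interchange a b c d = begin
      (a + b) + (c + d) ≈⟨ +-assoc a b (c + d) ⟩
      a + (b + (c + d)) ≈⟨ +-congˡ (sym (+-assoc b c d)) ⟩
      a + ((b + c) + d) ≈⟨ +-congˡ (+-congʳ (+-comm b c)) ⟩
      a + ((c + b) + d) ≈⟨ +-congˡ (+-assoc c b d) ⟩
      a + (c + (b + d)) ≈⟨ sym (+-assoc a c (b + d)) ⟩
      (a + c) + (b + d) ∎

  Σ-*ˡ : ∀ {n} a (f : Fin n → C) → a * Σ f ≈ Σ (λ k → a * f k)
  Σ-*ˡ {zero} a f = zeroʳ a
  Σ-*ˡ {suc n} a f = trans (distribˡ a (f zero) _) (+-congˡ (Σ-*ˡ a (λ k → f (suc k))))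

  Σ-*ʳ : ∀ {n} a (f : Fin n → C) → Σ f * a ≈ Σ (λ k → f k * a)
  Σ-*ʳ {zero} a f = zeroˡ a
  Σ-*ʳ {suc n} a f = trans (distribʳ a (f zero) _) (+-congˡ (Σ-*ʳ a (λ k → f (suc k))))

  Σ-neg : ∀ {n} (f : Fin n → C) → Σ (λ k → - f k) ≈ - Σ f
  Σ-neg {zero} f = sym ε⁻¹≈ε
  Σ-neg {suc n} f = trans (+-congˡ (Σ-neg (λ k → f (suc k)))) (⁻¹-∙-comm _ _)

  Σ-swap : ∀ {m n} (f : Fin m → Fin n → C) → Σ (λ i → Σ (λ j → f i j)) ≈ Σ (λ j → Σ (λ i → f i j))
  Σ-swap {zero} f = sym (Σ-zero {f = λ j → Σ (λ i → f i j)} (λ j → refl))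
  Σ-swap {suc m} f = trans (+-congˡ (Σ-swap (λ i j → f (suc i) j))) (sym (Σ-+ (λ j → f zero j) (λ j → Σ (λ i → f (suc i) j))))

  Σ-single : ∀ {n} (f : Fin n → C) j → (∀ k → k ≢ j → f k ≈ 0#) → Σ f ≈ f j
  Σ-single {suc n} f zero h = trans (+-congˡ (Σ-zero (λ k → h (suc k) (λ ())))) (+-identityʳ _)
  Σ-single {suc n} f (suc j) h =
    trans (+-cong (h zero (λ ())) (Σ-single (λ k → f (suc k)) j (λ k ne → h (suc k) (λ e → ne (suc-injective e)))))
          (+-identityˡ _)

  Σ-split : ∀ r s (f : Fin (r ℕ.+ s) → C) → Σ f ≈ Σ (λ a → f (a ↑ˡ s)) + Σ (λ b → f (r ↑ʳ b))
  Σ-split zero s f = sym (+-identityˡ _)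
  Σ-split (suc r) s f = trans (+-congˡ (Σ-split r s (λ k → f (suc k)))) (sym (+-assoc _ _ _))

  ·-cong : ∀ {n} {X X′ Y Y′ : Mat n C} → X ≋ X′ → Y ≋ Y′ → X · Y ≋ X′ · Y′
  ·-cong h k i j = Σ-cong (λ l → *-cong (h i l) (k l j))
  ⊞-cong : ∀ {n} {X X′ Y Y′ : Mat n C} → X ≋ X′ → Y ≋ Y′ → X ⊞ Y ≋ X′ ⊞ Y′
  ⊞-cong h k i j = +-cong (h i j) (k i j)
  ⊖-cong : ∀ {n} {X X′ : Mat n C} → X ≋ X′ → ⊖ X ≋ ⊖ X′
  ⊖-cong h i j = -‿cong (h i j)
  ⊟-cong : ∀ {n} {X X′ Y Y′ : Mat n C} → X ≋ X′ → Y ≋ Y′ → X ⊟ Y ≋ X′ ⊟ Y′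
  ⊟-cong h k = ⊞-cong h (⊖-cong k)
  ⋆-cong : ∀ {n} {s t} {X X′ : Mat n C} → s ≈ t → X ≋ X′ → s ⋆ X ≋ t ⋆ X′
  ⋆-cong e h i j = *-cong e (h i j)

  ·-congˡ : ∀ {n} (X : Mat n C) {Y Y′} → Y ≋ Y′ → X · Y ≋ X · Y′
  ·-congˡ X = ·-cong (≋-refl {X = X})
  ·-congʳ : ∀ {n} (Y : Mat n C) {X X′} → X ≋ X′ → X · Y ≋ X′ · Y
  ·-congʳ Y h = ·-cong h (≋-refl {X = Y})
  ⊞-congˡ : ∀ {n} (X : Mat n C) {Y Y′} → Y ≋ Y′ → X ⊞ Y ≋ X ⊞ Y′
  ⊞-congˡ X = ⊞-cong (≋-refl {X = X})
  ⊞-congʳ : ∀ {n} (Y : Mat n C) {X X′} → X ≋ X′ → X ⊞ Y ≋ X′ ⊞ Y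
  ⊞-congʳ Y h = ⊞-cong h (≋-refl {X = Y})
  ⊟-congˡ : ∀ {n} (X : Mat n C) {Y Y′} → Y ≋ Y′ → X ⊟ Y ≋ X ⊟ Y′
  ⊟-congˡ X = ⊟-cong (≋-refl {X = X})
  ⊟-congʳ : ∀ {n} (Y : Mat n C) {X X′} → X ≋ X′ → X ⊟ Y ≋ X′ ⊟ Y
  ⊟-congʳ Y h = ⊟-cong h (≋-refl {X = Y})
  ⋆-congˡ : ∀ {n} s {X X′ : Mat n C} → X ≋ X′ → s ⋆ X ≋ s ⋆ X′
  ⋆-congˡ s = ⋆-cong refl

  ·-assoc : ∀ {n} (X Y Z : Mat n C) → (X · Y) · Z ≋ X · (Y · Z)
  ·-assoc X Y Z i j = begin
    Σ (λ l → Σ (λ k → X i k * Y k l) * Z l j)   ≈⟨ Σ-cong (λ l → Σ-*ʳ (Z l j) (λ k → X i k * Y k l)) ⟩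
    Σ (λ l → Σ (λ k → X i k * Y k l * Z l j))   ≈⟨ Σ-swap (λ l k → X i k * Y k l * Z l j) ⟩
    Σ (λ k → Σ (λ l → X i k * Y k l * Z l j))   ≈⟨ Σ-cong (λ k → Σ-cong (λ l → *-assoc (X i k) (Y k l) (Z l j))) ⟩
    Σ (λ k → Σ (λ l → X i k * (Y k l * Z l j))) ≈⟨ Σ-cong (λ k → sym (Σ-*ˡ (X i k) (λ l → Y k l * Z l j))) ⟩
    Σ (λ k → X i k * Σ (λ l → Y k l * Z l j))   ∎

  ·-distribˡ : ∀ {n} (X Y Z : Mat n C) → X · (Y ⊞ Z) ≋ X · Y ⊞ X · Z
  ·-distribˡ X Y Z i j =
    trans (Σ-cong (λ k → distribˡ (X i k) (Y k j) (Z k j))) (Σ-+ (λ k → X i k * Y k j) (λ k → X i k * Z k j))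
  ·-distribʳ : ∀ {n} (X Y Z : Mat n C) → (Y ⊞ Z) · X ≋ Y · X ⊞ Z · X
  ·-distribʳ X Y Z i j =
    trans (Σ-cong (λ k → distribʳ (X k j) (Y i k) (Z i k))) (Σ-+ (λ k → Y i k * X k j) (λ k → Z i k * X k j))

  ·-negˡ : ∀ {n} (X Y : Mat n C) → (⊖ X) · Y ≋ ⊖ (X · Y)
  ·-negˡ X Y i j = trans (Σ-cong (λ k → sym (-‿distribˡ-* (X i k) (Y k j)))) (Σ-neg (λ k → X i k * Y k j))
  ·-negʳ : ∀ {n} (X Y : Mat n C) → X · (⊖ Y) ≋ ⊖ (X · Y)
  ·-negʳ X Y i j = trans (Σ-cong (λ k → sym (-‿distribʳ-* (X i k) (Y k j)))) (Σ-neg (λ k → X i k * Y k j))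

  ·-distribˡ-⊟ : ∀ {n} (X Y Z : Mat n C) → X · (Y ⊟ Z) ≋ X · Y ⊟ X · Z
  ·-distribˡ-⊟ X Y Z = ≋-trans (·-distribˡ X Y (⊖ Z)) (⊞-cong ≋-refl (·-negʳ X Z))
  ·-distribʳ-⊟ : ∀ {n} (X Y Z : Mat n C) → (Y ⊟ Z) · X ≋ Y · X ⊟ Z · X
  ·-distribʳ-⊟ X Y Z = ≋-trans (·-distribʳ X Y (⊖ Z)) (⊞-cong ≋-refl (·-negˡ Z X))

  ·-⋆ʳ : ∀ {n} s (X Y : Mat n C) → X · (s ⋆ Y) ≋ s ⋆ (X · Y)
  ·-⋆ʳ s X Y i j =
    trans (Σ-cong (λ k → trans (sym (*-assoc _ _ _)) (trans (*-congʳ (*-comm (X i k) s)) (*-assoc _ _ _))))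
          (sym (Σ-*ˡ s (λ k → X i k * Y k j)))

  ·-zeroʳ : ∀ {n} (X Y : Mat n C) → Y ≋ O → X · Y ≋ O
  ·-zeroʳ X Y h i j = Σ-zero (λ k → trans (*-congˡ (h k j)) (zeroʳ _))
  ⋆-zero : ∀ {n} s (X : Mat n C) → X ≋ O → s ⋆ X ≋ O
  ⋆-zero s X h i j = trans (*-congˡ (h i j)) (zeroʳ _)

  sc-diag : ∀ {n} s (i : Fin n) → sc s i i ≡ s
  sc-diag s i = diagM-diag 0# s (λ _ → s) i
  sc-off : ∀ {n} s (i j : Fin n) → i ≢ j → sc s i j ≡ 0#
  sc-off s i j ne = diagM-off 0# s (λ _ → s) i j ne

  sc-·ˡ : ∀ {n} s (X : Mat n C) → sc s · X ≋ s ⋆ X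
  sc-·ˡ s X i j =
    trans (Σ-single _ i (λ k ne → trans (*-congʳ (≡⇒≈ (sc-off s i k (λ e → ne (P.sym e))))) (zeroˡ _)))
          (*-congʳ (≡⇒≈ (sc-diag s i)))
  sc-·ʳ : ∀ {n} s (X : Mat n C) → X · sc s ≋ s ⋆ X
  sc-·ʳ s X i j =
    trans (Σ-single _ j (λ k ne → trans (*-congˡ (≡⇒≈ (sc-off s k j ne))) (zeroʳ _)))
          (trans (*-congˡ (≡⇒≈ (sc-diag s j))) (*-comm _ _))
  I-·ˡ : ∀ {n} (X : Mat n C) → I · X ≋ X
  I-·ˡ X i j = trans (sc-·ˡ 1# X i j) (*-identityˡ _)
  I-·ʳ : ∀ {n} (X : Mat n C) → X · I ≋ X
  I-·ʳ X i j = trans (sc-·ʳ 1# X i j) (*-identityˡ _)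

  neg-+ : ∀ x y → - (x + y) ≈ - x + - y
  neg-+ x y = sym (⁻¹-∙-comm x y)

  private
    sub-add-cancel : ∀ x y → (x + - y) + y ≈ x
    sub-add-cancel x y = trans (+-assoc _ _ _) (trans (+-congˡ (-‿inverseˡ y)) (+-identityʳ x))

    add-sub-cancelˡ : ∀ x y → (x + y) + - x ≈ y
    add-sub-cancelˡ x y = trans (+-congʳ (+-comm x y)) (trans (+-assoc _ _ _) (trans (+-congˡ (-‿inverseʳ x)) (+-identityʳ y)))

    sub-sub-cancel : ∀ x y → x + - (x + - y) ≈ y
    sub-sub-cancel x y = begin
      x + - (x + - y)   ≈⟨ +-congˡ (trans (neg-+ x (- y)) (+-congˡ (⁻¹-involutive y))) ⟩
      x + (- x + y)     ≈⟨ sym (+-assoc _ _ _) ⟩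
      (x + - x) + y     ≈⟨ +-congʳ (-‿inverseʳ x) ⟩
      0# + y            ≈⟨ +-identityˡ y ⟩
      y                 ∎

    sub-sub : ∀ x y z → (x + - y) + - z ≈ x + - (y + z)
    sub-sub x y z = trans (+-assoc _ _ _) (+-congˡ (sym (neg-+ y z)))

    add-sub-add-cancel : ∀ x y z → (x + y) + - (y + z) ≈ x + - z
    add-sub-add-cancel x y z = begin
      (x + y) + - (y + z)   ≈⟨ +-congʳ (+-comm x y) ⟩
      (y + x) + - (y + z)   ≈⟨ +-congˡ (neg-+ y z) ⟩
      (y + x) + (- y + - z) ≈⟨ sym (+-assoc _ _ _) ⟩
      ((y + x) + - y) + - z ≈⟨ +-congʳ (add-sub-cancelˡ y x) ⟩
      x + - z               ∎

    sub-sub-neg : ∀ a b c d → (a + - b) + - (c + - d) ≈ ((a + - b) + - c) + d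
    sub-sub-neg a b c d = trans (+-congˡ (trans (neg-+ c (- d)) (+-congˡ (⁻¹-involutive d)))) (sym (+-assoc _ _ _))

  ⊟-decompose : ∀ {n} (X Y : Mat n C) → X ≋ Y ⊞ (X ⊟ Y)
  ⊟-decompose X Y i j = sym (trans (+-comm _ _) (sub-add-cancel (X i j) (Y i j)))
  ⊞-⊟-cancelˡ : ∀ {n} (X Y : Mat n C) → (X ⊞ Y) ⊟ X ≋ Y
  ⊞-⊟-cancelˡ X Y i j = add-sub-cancelˡ (X i j) (Y i j)
  ⊟-⊟-cancel : ∀ {n} (X Y : Mat n C) → X ⊟ (X ⊟ Y) ≋ Y
  ⊟-⊟-cancel X Y i j = sub-sub-cancel (X i j) (Y i j)
  ⊟-⊟ : ∀ {n} (X Y Z : Mat n C) → X ⊟ Y ⊟ Z ≋ X ⊟ (Y ⊞ Z)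
  ⊟-⊟ X Y Z i j = sub-sub (X i j) (Y i j) (Z i j)
  ⊞-⊟-⊞-cancel : ∀ {n} (X Y Z : Mat n C) → (X ⊞ Y) ⊟ (Y ⊞ Z) ≋ X ⊟ Z
  ⊞-⊟-⊞-cancel X Y Z i j = add-sub-add-cancel (X i j) (Y i j) (Z i j)

  ⊟-·-⊟ : ∀ {n} (X Y Z V : Mat n C) → (X ⊟ Y) · (Z ⊟ V) ≋ X · Z ⊟ X · V ⊟ Y · Z ⊞ Y · V
  ⊟-·-⊟ X Y Z V =
    ≋-trans (·-distribʳ-⊟ (Z ⊟ V) X Y)
            (≋-trans (⊟-cong (·-distribˡ-⊟ X Z V) (·-distribˡ-⊟ Y Z V)) (λ i j → sub-sub-neg _ _ _ _))

  ≋⇒⊟≋O : ∀ {n} (X Y : Mat n C) → X ≋ Y → X ⊟ Y ≋ O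
  ≋⇒⊟≋O X Y h i j = trans (+-congˡ (-‿cong (sym (h i j)))) (-‿inverseʳ _)
  ⊟≋O⇒≋ : ∀ {n} (X Y : Mat n C) → X ⊟ Y ≋ O → X ≋ Y
  ⊟≋O⇒≋ X Y h i j = trans (sym (sub-add-cancel (X i j) (Y i j))) (trans (+-congʳ (h i j)) (+-identityˡ _))

  ⊞-O : ∀ {n} (X Y : Mat n C) → Y ≋ O → X ⊞ Y ≋ X
  ⊞-O X Y h i j = trans (+-congˡ (h i j)) (+-identityʳ _)
  ⊟-O : ∀ {n} (X Y : Mat n C) → Y ≋ O → X ⊟ Y ≋ X
  ⊟-O X Y h i j = trans (+-congˡ (trans (-‿cong (h i j)) ε⁻¹≈ε)) (+-identityʳ _)

  module ConjugateTranspose (cj : C → C) (cj-cong : ∀ {x y} → x ≈ y → cj x ≈ cj y)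
      (cj-+ : ∀ x y → cj (x + y) ≈ cj x + cj y) (cj-* : ∀ x y → cj (x * y) ≈ cj x * cj y)
      (cj-0 : cj 0# ≈ 0#) (cj-neg : ∀ x → cj (- x) ≈ - cj x) (cj-cj : ∀ x → cj (cj x) ≈ x) where

    infix 9 _*
    _* : ∀ {n} → Mat n C → Mat n C
    X * = conjT cj X

    cj-Σ : ∀ {n} (f : Fin n → C) → cj (Σ f) ≈ Σ (λ k → cj (f k))
    cj-Σ {zero} f = cj-0
    cj-Σ {suc n} f = trans (cj-+ _ _) (+-congˡ (cj-Σ (λ k → f (suc k))))

    *-· : ∀ {n} (X Y : Mat n C) → (X · Y) * ≋ Y * · X *
    *-· X Y i j = trans (cj-Σ (λ k → X j k * Y k i)) (Σ-cong {g = λ k → cj (Y k i) * cj (X j k)} (λ k → trans (cj-* _ _) (*-comm _ _)))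
    *-involutive : ∀ {n} (X : Mat n C) → (X *) * ≋ X
    *-involutive X i j = cj-cj _
    *-⊞ : ∀ {n} (X Y : Mat n C) → (X ⊞ Y) * ≋ X * ⊞ Y *
    *-⊞ X Y i j = cj-+ _ _
    *-⊖ : ∀ {n} (X : Mat n C) → (⊖ X) * ≋ ⊖ (X *)
    *-⊖ X i j = cj-neg _
    *-⋆ : ∀ {n} s (X : Mat n C) → (s ⋆ X) * ≋ cj s ⋆ X *
    *-⋆ s X i j = cj-* _ _
    *-sc : ∀ {n} s → sc {n} s * ≋ sc (cj s)
    *-sc s i j with i Fin.≟ j
    ... | yes P.refl = trans (cj-cong (≡⇒≈ (sc-diag s i))) (≡⇒≈ (P.sym (sc-diag (cj s) i)))
    ... | no ne = trans (cj-cong (≡⇒≈ (sc-off s j i (λ e → ne (P.sym e))))) (trans cj-0 (≡⇒≈ (P.sym (sc-off (cj s) i j ne))))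

  module Blocks (r s : ℕ) where

    bd : Mat r C → Mat s C → Mat (r ℕ.+ s) C
    bd X Y = blockDiag 0# r s X Y

    topLeft : Mat (r ℕ.+ s) C → Mat r C
    topLeft A a b = A (a ↑ˡ s) (b ↑ˡ s)

    bottomRight : Mat (r ℕ.+ s) C → Mat s C
    bottomRight A a b = A (r ↑ʳ a) (r ↑ʳ b)

    record IsBlockDiagonal (A : Mat (r ℕ.+ s) C) : Set where
      field
        upper : ∀ a b → A (a ↑ˡ s) (r ↑ʳ b) ≈ 0#
        lower : ∀ a b → A (r ↑ʳ a) (b ↑ˡ s) ≈ 0#
    open IsBlockDiagonal public

    private
      bd-ll = blockDiag-ll 0# r s
      bd-lr = blockDiag-lr 0# r s
      bd-rl = blockDiag-rl 0# r s
      bd-rr = blockDiag-rr 0# r s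

    bd-cong : ∀ {A B : Mat r C} {A′ B′ : Mat s C} → A ≋ B → A′ ≋ B′ → bd A A′ ≋ bd B B′
    bd-cong h k i j with blockView r s i | blockView r s j
    ... | left a  | left b  = trans (≡⇒≈ (bd-ll _ _ a b)) (trans (h a b) (≡⇒≈ (P.sym (bd-ll _ _ a b))))
    ... | left a  | right b = trans (≡⇒≈ (bd-lr _ _ a b)) (≡⇒≈ (P.sym (bd-lr _ _ a b)))
    ... | right a | left b  = trans (≡⇒≈ (bd-rl _ _ a b)) (≡⇒≈ (P.sym (bd-rl _ _ a b)))
    ... | right a | right b = trans (≡⇒≈ (bd-rr _ _ a b)) (trans (k a b) (≡⇒≈ (P.sym (bd-rr _ _ a b))))

    bd-· : ∀ (A B : Mat r C) (A′ B′ : Mat s C) → bd A A′ · bd B B′ ≋ bd (A · B) (A′ · B′)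
    bd-· A B A′ B′ i j with blockView r s i | blockView r s j
    ... | left a | left b = begin
      Σ (λ k → bd A A′ (a ↑ˡ s) k * bd B B′ k (b ↑ˡ s))                   ≈⟨ Σ-split r s _ ⟩
      Σ (λ k → bd A A′ (a ↑ˡ s) (k ↑ˡ s) * bd B B′ (k ↑ˡ s) (b ↑ˡ s))
        + Σ (λ k → bd A A′ (a ↑ˡ s) (r ↑ʳ k) * bd B B′ (r ↑ʳ k) (b ↑ˡ s))
          ≈⟨ +-cong (Σ-cong (λ k → *-cong (≡⇒≈ (bd-ll A A′ a k)) (≡⇒≈ (bd-ll B B′ k b))))
                    (Σ-zero (λ k → trans (*-congʳ (≡⇒≈ (bd-lr A A′ a k))) (zeroˡ _))) ⟩
      (A · B) a b + 0#                                                    ≈⟨ +-identityʳ _ ⟩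
      (A · B) a b                                                         ≈⟨ ≡⇒≈ (P.sym (bd-ll (A · B) (A′ · B′) a b)) ⟩
      bd (A · B) (A′ · B′) (a ↑ˡ s) (b ↑ˡ s)                               ∎
    ... | left a | right b = trans (Σ-split r s _)
      (trans (+-cong (Σ-zero (λ k → trans (*-congˡ (≡⇒≈ (bd-lr B B′ k b))) (zeroʳ _)))
                     (Σ-zero (λ k → trans (*-congʳ (≡⇒≈ (bd-lr A A′ a k))) (zeroˡ _))))
             (trans (+-identityˡ 0#) (≡⇒≈ (P.sym (bd-lr (A · B) (A′ · B′) a b)))))
    ... | right a | left b = trans (Σ-split r s _)
      (trans (+-cong (Σ-zero (λ k → trans (*-congʳ (≡⇒≈ (bd-rl A A′ a k))) (zeroˡ _)))
                     (Σ-zero (λ k → trans (*-congˡ (≡⇒≈ (bd-rl B B′ k b))) (zeroʳ _))))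
             (trans (+-identityˡ 0#) (≡⇒≈ (P.sym (bd-rl (A · B) (A′ · B′) a b)))))
    ... | right a | right b = begin
      Σ (λ k → bd A A′ (r ↑ʳ a) k * bd B B′ k (r ↑ʳ b))                   ≈⟨ Σ-split r s _ ⟩
      Σ (λ k → bd A A′ (r ↑ʳ a) (k ↑ˡ s) * bd B B′ (k ↑ˡ s) (r ↑ʳ b))
        + Σ (λ k → bd A A′ (r ↑ʳ a) (r ↑ʳ k) * bd B B′ (r ↑ʳ k) (r ↑ʳ b))
          ≈⟨ +-cong (Σ-zero (λ k → trans (*-congʳ (≡⇒≈ (bd-rl A A′ a k))) (zeroˡ _)))
                    (Σ-cong (λ k → *-cong (≡⇒≈ (bd-rr A A′ a k)) (≡⇒≈ (bd-rr B B′ k b)))) ⟩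
      0# + (A′ · B′) a b                                                  ≈⟨ +-identityˡ _ ⟩
      (A′ · B′) a b                                                       ≈⟨ ≡⇒≈ (P.sym (bd-rr (A · B) (A′ · B′) a b)) ⟩
      bd (A · B) (A′ · B′) (r ↑ʳ a) (r ↑ʳ b)                               ∎

    topLeft-sc : ∀ t → topLeft (sc t) ≋ sc t
    topLeft-sc t a b with a Fin.≟ b
    ... | yes P.refl = ≡⇒≈ (P.trans (sc-diag t (a ↑ˡ s)) (P.sym (sc-diag t a)))
    ... | no ne = ≡⇒≈ (P.trans (sc-off t _ _ (λ e → ne (↑ˡ-injective s a b e))) (P.sym (sc-off t a b ne)))

    bottomRight-sc : ∀ t → bottomRight (sc t) ≋ sc t
    bottomRight-sc t a b with a Fin.≟ b
    ... | yes P.refl = ≡⇒≈ (P.trans (sc-diag t (r ↑ʳ a)) (P.sym (sc-diag t a)))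
    ... | no ne = ≡⇒≈ (P.trans (sc-off t _ _ (λ e → ne (↑ʳ-injective r a b e))) (P.sym (sc-off t a b ne)))

    bd-sc : ∀ t → bd (sc t) (sc t) ≋ sc t
    bd-sc t i j with blockView r s i | blockView r s j
    ... | left a  | left b  = trans (≡⇒≈ (bd-ll _ _ a b)) (sym (topLeft-sc t a b))
    ... | left a  | right b = trans (≡⇒≈ (bd-lr _ _ a b)) (≡⇒≈ (P.sym (sc-off t _ _ (↑ˡ≢↑ʳ a b))))
    ... | right a | left b  = trans (≡⇒≈ (bd-rl _ _ a b)) (≡⇒≈ (P.sym (sc-off t _ _ (λ e → ↑ˡ≢↑ʳ b a (P.sym e)))))
    ... | right a | right b = trans (≡⇒≈ (bd-rr _ _ a b)) (sym (bottomRight-sc t a b))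

    IsBlockDiagonal⇒≋bd : ∀ {A} → IsBlockDiagonal A → A ≋ bd (topLeft A) (bottomRight A)
    IsBlockDiagonal⇒≋bd {A} h i j with blockView r s i | blockView r s j
    ... | left a  | left b  = ≡⇒≈ (P.sym (bd-ll _ _ a b))
    ... | left a  | right b = trans (upper h a b) (≡⇒≈ (P.sym (bd-lr _ _ a b)))
    ... | right a | left b  = trans (lower h a b) (≡⇒≈ (P.sym (bd-rl _ _ a b)))
    ... | right a | right b = ≡⇒≈ (P.sym (bd-rr _ _ a b))

    topLeft-·ˡ : ∀ {A} B → IsBlockDiagonal A → topLeft (A · B) ≋ topLeft A · topLeft B
    topLeft-·ˡ B h a b = trans (Σ-split r s _) (trans (+-congˡ (Σ-zero (λ k → trans (*-congʳ (upper h a k)) (zeroˡ _)))) (+-identityʳ _))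
    topLeft-·ʳ : ∀ A {B} → IsBlockDiagonal B → topLeft (A · B) ≋ topLeft A · topLeft B
    topLeft-·ʳ A h a b = trans (Σ-split r s _) (trans (+-congˡ (Σ-zero (λ k → trans (*-congˡ (lower h k b)) (zeroʳ _)))) (+-identityʳ _))
    bottomRight-·ˡ : ∀ {A} B → IsBlockDiagonal A → bottomRight (A · B) ≋ bottomRight A · bottomRight B
    bottomRight-·ˡ B h a b = trans (Σ-split r s _) (trans (+-congʳ (Σ-zero (λ k → trans (*-congʳ (lower h a k)) (zeroˡ _)))) (+-identityˡ _))
    bottomRight-·ʳ : ∀ A {B} → IsBlockDiagonal B → bottomRight (A · B) ≋ bottomRight A · bottomRight B
    bottomRight-·ʳ A h a b = trans (Σ-split r s _) (trans (+-congʳ (Σ-zero (λ k → trans (*-congˡ (upper h k b)) (zeroʳ _)))) (+-identityˡ _))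

    D : C → C → Mat (r ℕ.+ s) C
    D x y = bd (sc x) (sc y)

    D-off : ∀ x y k j → k ≢ j → D x y k j ≈ 0#
    D-off x y k j ne with blockView r s k | blockView r s j
    ... | left a  | left b  = trans (≡⇒≈ (bd-ll _ _ a b)) (≡⇒≈ (sc-off x a b (λ e → ne (P.cong (_↑ˡ s) e))))
    ... | left a  | right b = ≡⇒≈ (bd-lr _ _ a b)
    ... | right a | left b  = ≡⇒≈ (bd-rl _ _ a b)
    ... | right a | right b = trans (≡⇒≈ (bd-rr _ _ a b)) (≡⇒≈ (sc-off y a b (λ e → ne (P.cong (r ↑ʳ_) e))))

    ·D-colˡ : ∀ x y (A : Mat (r ℕ.+ s) C) i b → (A · D x y) i (b ↑ˡ s) ≈ A i (b ↑ˡ s) * x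
    ·D-colˡ x y A i b = trans (Σ-single _ (b ↑ˡ s) (λ k ne → trans (*-congˡ (D-off x y k _ ne)) (zeroʳ _)))
                              (*-congˡ (≡⇒≈ (P.trans (bd-ll _ _ b b) (sc-diag x b))))
    ·D-colʳ : ∀ x y (A : Mat (r ℕ.+ s) C) i b → (A · D x y) i (r ↑ʳ b) ≈ A i (r ↑ʳ b) * y
    ·D-colʳ x y A i b = trans (Σ-single _ (r ↑ʳ b) (λ k ne → trans (*-congˡ (D-off x y k _ ne)) (zeroʳ _)))
                              (*-congˡ (≡⇒≈ (P.trans (bd-rr _ _ b b) (sc-diag y b))))
    D·-rowˡ : ∀ x y (A : Mat (r ℕ.+ s) C) a j → (D x y · A) (a ↑ˡ s) j ≈ x * A (a ↑ˡ s) j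
    D·-rowˡ x y A a j = trans (Σ-single _ (a ↑ˡ s) (λ k ne → trans (*-congʳ (D-off x y _ k (λ e → ne (P.sym e)))) (zeroˡ _)))
                              (*-congʳ (≡⇒≈ (P.trans (bd-ll _ _ a a) (sc-diag x a))))
    D·-rowʳ : ∀ x y (A : Mat (r ℕ.+ s) C) a j → (D x y · A) (r ↑ʳ a) j ≈ y * A (r ↑ʳ a) j
    D·-rowʳ x y A a j = trans (Σ-single _ (r ↑ʳ a) (λ k ne → trans (*-congʳ (D-off x y _ k (λ e → ne (P.sym e)))) (zeroˡ _)))
                              (*-congʳ (≡⇒≈ (P.trans (bd-rr _ _ a a) (sc-diag y a))))

    bd-·-D : ∀ x y (X : Mat r C) (Y : Mat s C) → bd X Y · D x y ≋ D x y · bd X Y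
    bd-·-D x y X Y = ≋-trans (bd-· X (sc x) Y (sc y))
      (≋-trans (bd-cong (≋-trans (sc-·ʳ x X) (≋-sym (sc-·ˡ x X))) (≋-trans (sc-·ʳ y Y) (≋-sym (sc-·ˡ y Y))))
               (≋-sym (bd-· (sc x) X (sc y) Y)))

    commutes-D-upper : ∀ x y (A : Mat (r ℕ.+ s) C) → A · D x y ≋ D x y · A
      → ∀ a b → A (a ↑ˡ s) (r ↑ʳ b) * y ≈ x * A (a ↑ˡ s) (r ↑ʳ b)
    commutes-D-upper x y A h a b = trans (sym (·D-colʳ x y A _ b)) (trans (h _ _) (D·-rowˡ x y A a _))

    commutes-D-lower : ∀ x y (A : Mat (r ℕ.+ s) C) → A · D x y ≋ D x y · A
      → ∀ a b → A (r ↑ʳ a) (b ↑ˡ s) * x ≈ y * A (r ↑ʳ a) (b ↑ˡ s)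
    commutes-D-lower x y A h a b = trans (sym (·D-colˡ x y A _ b)) (trans (h _ _) (D·-rowʳ x y A a _))


module MatricesModulo (α : ℤ) where

  open import Defs
  open QuadraticOrder
  open Multiplicative α
  open OrderLaws α using (conj-⊕; conj-⊗; conj-involutive)
  open import Data.Nat as ℕ using (ℕ)
  import Data.Nat.Divisibility as ℕD
  open import Relation.Binary.PropositionalEquality using (refl)

  module M (m : ℕ) = Matrices (ResidueRing α m)

  -- the matrix operations do not depend on the modulus
  open M 0 public using (_·_; _⊞_; _⊟_; ⊖; _⋆_; sc; I; O)

  infix 4 _≋[_]_
  _≋[_]_ : ∀ {n} → Mat n Zφ → ℕ → Mat n Zφ → Set
  X ≋[ m ] Y = M._≋_ m X Y

  toMatCong : ∀ {n} {m} {X Y : Mat n Zφ} → X ≋[ m ] Y → MatCong CongZφ m X Y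
  toMatCong h i j = toCongZφ (h i j)

  fromMatCong : ∀ {n} {m} {X Y : Mat n Zφ} → MatCong CongZφ m X Y → X ≋[ m ] Y
  fromMatCong h i j = fromCongZφ (h i j)

  ≋-weaken : ∀ {n} {a b} {X Y : Mat n Zφ} → a ℕD.∣ b → X ≋[ b ] Y → X ≋[ a ] Y
  ≋-weaken d h i j = modEqφ-weaken d (h i j)

  ·-divisible : ∀ {n} {a b} (X Y : Mat n Zφ) → X ≋[ a ] O → Y ≋[ b ] O → X · Y ≋[ a ℕ.* b ] O
  ·-divisible {a = a} {b} X Y h k i j = M.Σ-zero (a ℕ.* b) (λ l → modEqφ-zero-* (h i l) (k l j))

  ⋆-unit : ∀ {n} {a b} t (X : Mat n Zφ) → ModEqφ a t oneφ → X ≋[ b ] O → t ⋆ X ≋[ a ℕ.* b ] X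
  ⋆-unit t X h k i j = modEqφ-unit-* h (k i j)

  module ConjT (m : ℕ) = M.ConjugateTranspose m conjφ conjφ-cong
    (λ x y → modEqφ-reflexive (conj-⊕ x y)) (λ x y → modEqφ-reflexive (conj-⊗ x y))
    (modEqφ-reflexive refl) (λ x → modEqφ-reflexive refl) (λ x → modEqφ-reflexive (conj-involutive x))

  _ᴴ : ∀ {n} → Mat n Zφ → Mat n Zφ
  X ᴴ = conjT conjφ X
  infix 9 _ᴴ


-- Hensel lifting of matrices modulo p to compatible systems modulo p^k:
-- a Newton iteration for inverses, and a correction step that lifts a
-- solution of A* A = c from modulus p^(k+1) to p^(k+2) when 2c is a unit.
module MatrixLifting (α : ℤ) (p : ℕ) where

  open import Defs
  open QuadraticOrder
  open MatricesModulo α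
  open import Data.Nat as ℕ using (ℕ; zero; suc)
  import Data.Nat.Properties as ℕP
  import Data.Nat.Divisibility as ℕD
  open import Data.Nat.Tactic.RingSolver using (solve-∀)
  open import Data.Product using (_×_; _,_; proj₁; proj₂)
  open import Relation.Binary.PropositionalEquality using (_≡_; refl; sym)

  p^ : ℕ → ℕ
  p^ k = p ℕ.^ k

  p^k∣p^[1+k] : ∀ k → p^ k ℕD.∣ p^ (suc k)
  p^k∣p^[1+k] k = ℕD.divides p refl

  p∣p^[1+k] : ∀ k → p ℕD.∣ p^ (suc k)
  p∣p^[1+k] k = ℕD.divides (p^ k) (ℕP.*-comm p (p^ k))

  p^1∣p : p^ 1 ℕD.∣ p
  p^1∣p = ℕD.∣-reflexive (ℕP.*-identityʳ p)

  p∣p^1 : p ℕD.∣ p^ 1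
  p∣p^1 = ℕD.∣-reflexive (sym (ℕP.*-identityʳ p))

  p^[2+k]∣p^[1+k]² : ∀ k → p^ (suc (suc k)) ℕD.∣ (p^ (suc k) ℕ.* p^ (suc k))
  p^[2+k]∣p^[1+k]² k = ℕD.divides (p^ k) (lem p (p^ k))
    where lem : ∀ p x → (p ℕ.* x) ℕ.* (p ℕ.* x) ≡ x ℕ.* (p ℕ.* (p ℕ.* x))
          lem = solve-∀

  ·-divisible² : ∀ {n} k (X Y : Mat n Zφ) → X ≋[ p^ (suc k) ] O → Y ≋[ p^ (suc k) ] O → X · Y ≋[ p^ (suc (suc k)) ] O
  ·-divisible² k X Y h h′ = ≋-weaken (p^[2+k]∣p^[1+k]² k) (·-divisible X Y h h′)

  newtonStep : ∀ {n} → Mat n Zφ → Mat n Zφ → Mat n Zφ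
  newtonStep A Y = Y ⊟ Y · (A · Y ⊟ I)

  module NewtonStep {n : ℕ} (k : ℕ) (A Y : Mat n Zφ)
      (right-inv : A · Y ≋[ p^ (suc k) ] I) (left-inv : Y · A ≋[ p^ (suc k) ] I) where
    module R = M (p^ (suc (suc k)))
    open import Relation.Binary.Reasoning.Setoid (R.matSetoid n)

    E F : Mat n Zφ
    E = A · Y ⊟ I
    F = Y · A ⊟ I

    E² : E · E ≋[ p^ (suc (suc k)) ] O
    E² = ·-divisible² k E E (M.≋⇒⊟≋O _ _ _ right-inv) (M.≋⇒⊟≋O _ _ _ right-inv)
    F² : F · F ≋[ p^ (suc (suc k)) ] O
    F² = ·-divisible² k F F (M.≋⇒⊟≋O _ _ _ left-inv) (M.≋⇒⊟≋O _ _ _ left-inv)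

    -- the new Y Y′ satisfies A Y′ = I - E²
    right-inverse : A · newtonStep A Y ≋[ p^ (suc (suc k)) ] I
    right-inverse = begin
      A · (Y ⊟ Y · E)           ≈⟨ R.·-distribˡ-⊟ A Y (Y · E) ⟩
      A · Y ⊟ A · (Y · E)       ≈⟨ R.⊟-cong (R.⊟-decompose (A · Y) I) (R.≋-sym (R.·-assoc A Y E)) ⟩
      (I ⊞ E) ⊟ (A · Y) · E     ≈⟨ R.⊟-congˡ (I ⊞ E) (R.·-congʳ E (R.⊟-decompose (A · Y) I)) ⟩
      (I ⊞ E) ⊟ (I ⊞ E) · E     ≈⟨ R.⊟-congˡ (I ⊞ E) (R.≋-trans (R.·-distribʳ E I E) (R.⊞-congʳ (E · E) (R.I-·ˡ E))) ⟩
      (I ⊞ E) ⊟ (E ⊞ E · E)     ≈⟨ R.⊞-⊟-⊞-cancel I E (E · E) ⟩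
      I ⊟ E · E                 ≈⟨ R.⊟-O I (E · E) E² ⟩
      I                         ∎

    -- E A = A F, both being A Y A - A
    EA≋AF : E · A ≋[ p^ (suc (suc k)) ] A · F
    EA≋AF = begin
      (A · Y ⊟ I) · A           ≈⟨ R.·-distribʳ-⊟ A (A · Y) I ⟩
      (A · Y) · A ⊟ I · A       ≈⟨ R.⊟-cong (R.≋-trans (R.·-assoc A Y A) (R.·-congˡ A (R.⊟-decompose (Y · A) I))) (R.I-·ˡ A) ⟩
      A · (I ⊞ F) ⊟ A           ≈⟨ R.⊟-congʳ A (R.≋-trans (R.·-distribˡ A I F) (R.⊞-congʳ (A · F) (R.I-·ʳ A))) ⟩
      (A ⊞ A · F) ⊟ A           ≈⟨ R.⊞-⊟-cancelˡ A (A · F) ⟩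
      A · F                     ∎

    -- and Y′ A = I - F²
    left-inverse : newtonStep A Y · A ≋[ p^ (suc (suc k)) ] I
    left-inverse = begin
      (Y ⊟ Y · E) · A           ≈⟨ R.·-distribʳ-⊟ A Y (Y · E) ⟩
      Y · A ⊟ (Y · E) · A       ≈⟨ R.⊟-cong (R.⊟-decompose (Y · A) I) (R.≋-trans (R.·-assoc Y E A) (R.·-congˡ Y EA≋AF)) ⟩
      (I ⊞ F) ⊟ Y · (A · F)     ≈⟨ R.⊟-congˡ (I ⊞ F) (R.≋-trans (R.≋-sym (R.·-assoc Y A F)) (R.·-congʳ F (R.⊟-decompose (Y · A) I))) ⟩
      (I ⊞ F) ⊟ (I ⊞ F) · F     ≈⟨ R.⊟-congˡ (I ⊞ F) (R.≋-trans (R.·-distribʳ F I F) (R.⊞-congʳ (F · F) (R.I-·ˡ F))) ⟩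
      (I ⊞ F) ⊟ (F ⊞ F · F)     ≈⟨ R.⊞-⊟-⊞-cancel I F (F · F) ⟩
      I ⊟ F · F                 ≈⟨ R.⊟-O I (F · F) F² ⟩
      I                         ∎

  newton : ∀ {n} → Mat n Zφ → Mat n Zφ → ℕ → Mat n Zφ
  newton A Z zero = Z
  newton A Z (suc j) = newtonStep A (newton A Z j)

  newton-inverse : ∀ {n} (A Z : Mat n Zφ) → A · Z ≋[ p ] I → Z · A ≋[ p ] I
    → ∀ j → (A · newton A Z j ≋[ p^ (suc j) ] I) × (newton A Z j · A ≋[ p^ (suc j) ] I)
  newton-inverse A Z h h′ zero = ≋-weaken p^1∣p h , ≋-weaken p^1∣p h′
  newton-inverse A Z h h′ (suc j) =
    NewtonStep.right-inverse j A (newton A Z j) (proj₁ ih) (proj₂ ih) , NewtonStep.left-inverse j A (newton A Z j) (proj₁ ih) (proj₂ ih)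
    where ih = newton-inverse A Z h h′ j

  -- The unitary correction: for A with A* A ≡ c, the defect N = A* A - c is
  -- removed to the next order by A ↦ A - ε A N, where ε is an inverse of 2c.
  module UnitaryCorrection (c e : ℤ) where
    ĉ ε : Zφ
    ĉ = scalφ c
    ε = scalφ e

    defect : ∀ {n} → Mat n Zφ → Mat n Zφ
    defect A = A ᴴ · A ⊟ sc ĉ

    correct : ∀ {n} → Mat n Zφ → Mat n Zφ
    correct A = A ⊟ A · (ε ⋆ defect A)

    module Step (2cε≡1 : ModEqφ p (mulφ α (addφ α ĉ ĉ) ε) oneφ) {n : ℕ} (k : ℕ) (A : Mat n Zφ)
        (small : defect A ≋[ p^ (suc k) ] O) where
      module R = M (p^ (suc (suc k)))
      module RC = ConjT (p^ (suc (suc k)))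
      module Ring = CommutativeRing (ResidueRing α (p^ (suc (suc k))))
      open import Relation.Binary.Reasoning.Setoid (R.matSetoid n)

      W N P : Mat n Zφ
      W = A ᴴ · A
      N = defect A
      P = ε ⋆ N

      P-small : P ≋[ p^ (suc k) ] O
      P-small = M.⋆-zero _ ε N small

      -- W = c + N, so W P and P W are c P up to a square of the defect
      WP≋cP : W · P ≋[ p^ (suc (suc k)) ] ĉ ⋆ P
      WP≋cP = R.⊟≋O⇒≋ (W · P) (ĉ ⋆ P)
        (R.≋-trans (R.≋-sym (R.≋-trans (R.·-distribʳ-⊟ P W (sc ĉ)) (R.⊟-congˡ (W · P) (R.sc-·ˡ ĉ P))))
                   (·-divisible² k N P small P-small))
      PW≋cP : P · W ≋[ p^ (suc (suc k)) ] ĉ ⋆ P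
      PW≋cP = R.⊟≋O⇒≋ (P · W) (ĉ ⋆ P)
        (R.≋-trans (R.≋-sym (R.≋-trans (R.·-distribˡ-⊟ P W (sc ĉ)) (R.⊟-congˡ (P · W) (R.sc-·ʳ ĉ P))))
                   (·-divisible² k P N P-small small))
      PWP≋O : P · (W · P) ≋[ p^ (suc (suc k)) ] O
      PWP≋O = R.≋-trans (R.·-congˡ P WP≋cP) (R.≋-trans (R.·-⋆ʳ ĉ P P) (R.⋆-zero ĉ (P · P) (·-divisible² k P P P-small P-small)))

      -- W, N and P are hermitian, so (A - A P)* = A* - P A*
      W-hermitian : W ᴴ ≋[ p^ (suc (suc k)) ] W
      W-hermitian = R.≋-trans (RC.*-· (A ᴴ) A) (R.·-congˡ (A ᴴ) (RC.*-involutive A))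
      P-hermitian : P ᴴ ≋[ p^ (suc (suc k)) ] P
      P-hermitian = R.≋-trans (RC.*-⋆ ε N) (R.⋆-congˡ ε N-hermitian)
        where
        N-hermitian : N ᴴ ≋[ p^ (suc (suc k)) ] N
        N-hermitian = R.≋-trans (RC.*-⊞ W (⊖ (sc ĉ)))
          (R.⊞-cong W-hermitian (R.≋-trans (RC.*-⊖ (sc ĉ)) (R.⊖-cong (RC.*-sc ĉ))))
      correct-ᴴ : (A ⊟ A · P) ᴴ ≋[ p^ (suc (suc k)) ] A ᴴ ⊟ P · A ᴴ
      correct-ᴴ = R.≋-trans (RC.*-⊞ A (⊖ (A · P)))
        (R.⊞-congˡ (A ᴴ) (R.≋-trans (RC.*-⊖ (A · P)) (R.⊖-cong (R.≋-trans (RC.*-· A P) (R.·-congʳ (A ᴴ) P-hermitian)))))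

      -- 2c P = (2 c ε) N ≡ N
      2cP≋N : ĉ ⋆ P ⊞ ĉ ⋆ P ≋[ p^ (suc (suc k)) ] N
      2cP≋N = R.≋-trans (λ i j → Ring.trans (Ring.sym (Ring.distribʳ (mulφ α ε (N i j)) ĉ ĉ))
                                            (Ring.sym (Ring.*-assoc (addφ α ĉ ĉ) ε (N i j))))
                        (⋆-unit _ N 2cε≡1 small)

      unitary : correct A ᴴ · correct A ≋[ p^ (suc (suc k)) ] sc ĉ
      unitary = begin
        (A ⊟ A · P) ᴴ · (A ⊟ A · P)       ≈⟨ R.·-congʳ (A ⊟ A · P) correct-ᴴ ⟩
        (A ᴴ ⊟ P · A ᴴ) · (A ⊟ A · P)     ≈⟨ R.⊟-·-⊟ (A ᴴ) (P · A ᴴ) A (A · P) ⟩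
        W ⊟ A ᴴ · (A · P) ⊟ (P · A ᴴ) · A ⊞ (P · A ᴴ) · (A · P)
          ≈⟨ R.⊞-cong (R.⊟-cong (R.⊟-congˡ W (R.≋-sym (R.·-assoc (A ᴴ) A P))) (R.·-assoc P (A ᴴ) A))
                      (R.≋-trans (R.·-assoc P (A ᴴ) (A · P)) (R.·-congˡ P (R.≋-sym (R.·-assoc (A ᴴ) A P)))) ⟩
        W ⊟ W · P ⊟ P · W ⊞ P · (W · P)    ≈⟨ R.⊞-cong (R.⊟-cong (R.⊟-congˡ W WP≋cP) PW≋cP) PWP≋O ⟩
        W ⊟ ĉ ⋆ P ⊟ ĉ ⋆ P ⊞ O              ≈⟨ R.⊞-O _ O (λ i j → Ring.refl) ⟩
        W ⊟ ĉ ⋆ P ⊟ ĉ ⋆ P                  ≈⟨ R.⊟-⊟ W (ĉ ⋆ P) (ĉ ⋆ P) ⟩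
        W ⊟ (ĉ ⋆ P ⊞ ĉ ⋆ P)                ≈⟨ R.⊟-congˡ W 2cP≋N ⟩
        W ⊟ N                              ≈⟨ R.⊟-⊟-cancel W (sc ĉ) ⟩
        sc ĉ                               ∎

      defect-correct : defect (correct A) ≋[ p^ (suc (suc k)) ] O
      defect-correct = R.≋⇒⊟≋O _ _ unitary

      correct-close : correct A ≋[ p^ (suc k) ] A
      correct-close = M.⊟-O _ A (A · P) (M.·-zeroʳ _ A P P-small)

    module Lift (2cε≡1 : ModEqφ p (mulφ α (addφ α ĉ ĉ) ε) oneφ) {n : ℕ} (A₀ Z₀ : Mat n Zφ)
        (unitary₀ : A₀ ᴴ · A₀ ≋[ p ] sc ĉ) (right₀ : A₀ · Z₀ ≋[ p ] I) (left₀ : Z₀ · A₀ ≋[ p ] I) where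

      A : ℕ → Mat n Zφ
      A zero = A₀
      A (suc k) = correct (A k)

      A-defect : ∀ k → defect (A k) ≋[ p^ (suc k) ] O
      A-defect zero = ≋-weaken p^1∣p (M.≋⇒⊟≋O p _ _ unitary₀)
      A-defect (suc k) = Step.defect-correct 2cε≡1 k (A k) (A-defect k)

      A-step : ∀ k → A (suc k) ≋[ p^ (suc k) ] A k
      A-step k = Step.correct-close 2cε≡1 k (A k) (A-defect k)

      A-coherent : ∀ k → A (suc k) ≋[ p^ k ] A k
      A-coherent k = ≋-weaken (p^k∣p^[1+k] k) (A-step k)

      A-mod-p : ∀ k → A k ≋[ p ] A₀
      A-mod-p zero = M.≋-refl p
      A-mod-p (suc k) = M.≋-trans p (≋-weaken (p∣p^[1+k] k) (A-step k)) (A-mod-p k)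

      A-unitary : ∀ k → A k ᴴ · A k ≋[ p^ k ] sc ĉ
      A-unitary k = ≋-weaken (p^k∣p^[1+k] k) (M.⊟≋O⇒≋ (p^ (suc k)) _ _ (A-defect k))

      Y : ℕ → Mat n Zφ
      Y k = newton (A k) Z₀ k

      Y-inverse : ∀ k → (A k · Y k ≋[ p^ (suc k) ] I) × (Y k · A k ≋[ p^ (suc k) ] I)
      Y-inverse k = newton-inverse (A k) Z₀ (M.≋-trans p (M.·-congʳ p Z₀ (A-mod-p k)) right₀)
                                            (M.≋-trans p (M.·-congˡ p Z₀ (A-mod-p k)) left₀) k

      Y-right : ∀ k → A k · Y k ≋[ p^ k ] I
      Y-right k = ≋-weaken (p^k∣p^[1+k] k) (proj₁ (Y-inverse k))
      Y-left : ∀ k → Y k · A k ≋[ p^ k ] I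
      Y-left k = ≋-weaken (p^k∣p^[1+k] k) (proj₂ (Y-inverse k))

      -- inverses of congruent matrices are congruent: Y′ ≡ Y′ (A Y) ≡ (Y′ A′) Y ≡ Y
      Y-coherent : ∀ k → Y (suc k) ≋[ p^ k ] Y k
      Y-coherent k = begin
          Y′                     ≈⟨ R.≋-sym (R.I-·ʳ Y′) ⟩
          Y′ · I                 ≈⟨ R.·-congˡ Y′ (R.≋-sym (Y-right k)) ⟩
          Y′ · (A k · Y k)       ≈⟨ R.≋-sym (R.·-assoc Y′ (A k) (Y k)) ⟩
          (Y′ · A k) · Y k       ≈⟨ R.·-congʳ (Y k) (R.·-congˡ Y′ (R.≋-sym (A-coherent k))) ⟩
          (Y′ · A (suc k)) · Y k ≈⟨ R.·-congʳ (Y k) (≋-weaken (ℕD.∣-trans (p^k∣p^[1+k] k) (p^k∣p^[1+k] (suc k))) (proj₂ (Y-inverse (suc k)))) ⟩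
          I · Y k                ≈⟨ R.I-·ˡ (Y k) ⟩
          Y k                    ∎
        where
        Y′ = Y (suc k)
        module R = M (p^ k)
        open import Relation.Binary.Reasoning.Setoid (R.matSetoid n)


module ResiduesModPrime {p : ℕ} (isPrime : Prime p) where

  open import Defs using (IsUnitZp)
  open IntegerCongruence
  open import Data.Nat as ℕ using (ℕ; zero; suc)
  import Data.Nat.Properties as ℕP
  import Data.Nat.Divisibility as ℕD
  open import Data.Nat.Primality using (euclidsLemma; prime⇒irreducible; irreducible[2]; prime⇒nonTrivial)
  open import Data.Nat.Coprimality using (Coprime; coprime-Bézout)
  open import Data.Nat.GCD using (module Bézout)
  import Data.Nat.Tactic.RingSolver as ℕSolver
  open import Data.Integer as ℤ using (ℤ; +_; -[1+_]; _+_; _*_; -_; _-_)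
  import Data.Integer.Properties as ℤP
  open import Data.Integer.Divisibility.Signed using (divides)
  open import Data.Integer.Tactic.RingSolver using (solve-∀)
  open import Data.Product using (Σ; _,_; proj₁; proj₂)
  open import Data.Sum using (_⊎_; inj₁; inj₂)
  open import Data.Empty using (⊥-elim)
  open import Relation.Nullary using (¬_)
  open import Relation.Binary.PropositionalEquality using (_≡_; _≢_; refl; sym; trans; cong; subst)

  p≢1 : p ≢ 1
  p≢1 refl with prime⇒nonTrivial isPrime
  ... | ()

  p∤1 : ¬ ((+ p) ∣ (+ 1))
  p∤1 d = p≢1 (ℕD.∣1⇒≡1 d)

  unit⇒p∤ : ∀ c d → ModEq p (c * d) (+ 1) → ¬ ((+ p) ∣ c)
  unit⇒p∤ c d cd≡1 p∣c =
    p∤1 (modEq⇒∣ (modEq-trans (modEq-sym cd≡1) (modEq-* (∣⇒≡0 {a = c} p∣c) (modEq-refl {a = d}))) (ℤP.+-identityʳ (+ 1)))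

  euclid : ∀ x y → (+ p) ∣ (x * y) → ((+ p) ∣ x) ⊎ ((+ p) ∣ y)
  euclid x y d = euclidsLemma (ℤ.∣ x ∣) (ℤ.∣ y ∣) isPrime (subst (p ℕD.∣_) (ℤP.abs-* x y) d)

  p∤2 : p ≢ 2 → ¬ ((+ p) ∣ (+ 2))
  p∤2 p≢2 d with irreducible[2] d
  ... | inj₁ p≡1 = p≢1 p≡1
  ... | inj₂ p≡2 = p≢2 p≡2

  p∤c+c : p ≢ 2 → ∀ c → ¬ ((+ p) ∣ c) → ¬ ((+ p) ∣ (c + c))
  p∤c+c p≢2 c p∤c d with euclid (+ 2) c (subst ((+ p) ∣_) (lem c) d)
    where lem : ∀ c → c + c ≡ + 2 * c
          lem = solve-∀
  ... | inj₁ p∣2 = p∤2 p≢2 p∣2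
  ... | inj₂ p∣c = p∤c p∣c

  inverseℕ : ∀ n → ¬ (p ℕD.∣ n) → Σ ℤ λ u → ModEq p (+ n * u) (+ 1)
  inverseℕ n p∤n with coprime-Bézout coprime
    where
    coprime : Coprime p n
    coprime {d} (d∣p , d∣n) with prime⇒irreducible isPrime d∣p
    ... | inj₁ d≡1 = d≡1
    ... | inj₂ refl = ⊥-elim (p∤n d∣n)
  ... | Bézout.+- a b eq = - (+ b) , modEq-via (+ n * - (+ b)) (+ 1) (sym (lem (+ n) (+ b) (+ a) (+ p) (cast eq)))
                                       (divides (- (+ a)) refl)
    where
    cast : 1 ℕ.+ b ℕ.* n ≡ a ℕ.* p → + 1 + + b * + n ≡ + a * + p
    cast e = trans (cong (λ z → + 1 + z) (sym (ℤP.pos-* b n))) (trans (cong +_ e) (ℤP.pos-* a p))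
    lem : ∀ n b a p → + 1 + b * n ≡ a * p → n * (- b) - + 1 ≡ (- a) * p
    lem n b a p e = trans (l1 n b) (trans (cong -_ e) (l2 a p))
      where l1 : ∀ n b → n * (- b) - + 1 ≡ - (+ 1 + b * n)
            l1 = solve-∀
            l2 : ∀ a p → - (a * p) ≡ (- a) * p
            l2 = solve-∀
  ... | Bézout.-+ a b eq = + b , modEq-via (+ n * + b) (+ 1) (sym (lem (+ n) (+ b) (+ a) (+ p) (cast eq)))
                                   (divides (+ a) refl)
    where
    cast : 1 ℕ.+ a ℕ.* p ≡ b ℕ.* n → + 1 + + a * + p ≡ + b * + n
    cast e = trans (cong (λ z → + 1 + z) (sym (ℤP.pos-* a p))) (trans (cong +_ e) (ℤP.pos-* b n))
    lem : ∀ n b a p → + 1 + a * p ≡ b * n → n * b - + 1 ≡ a * p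
    lem n b a p e = trans (cong (_- + 1) (trans (ℤP.*-comm n b) (sym e))) (l a p)
      where l : ∀ a p → (+ 1 + a * p) - + 1 ≡ a * p
            l = solve-∀

  inverse : ∀ x → ¬ ((+ p) ∣ x) → Σ ℤ λ u → ModEq p (x * u) (+ 1)
  inverse (+ n) p∤x = inverseℕ n p∤x
  inverse -[1+ n ] p∤x with inverseℕ (suc n) p∤x
  ... | u , nu≡1 = - u , modEq-trans (modEq-reflexive (lem (+ suc n) u)) nu≡1
    where lem : ∀ y u → (- y) * (- u) ≡ y * u
          lem = solve-∀

  -- An integer c prime to p is a unit of ℤ_p: Newton's iteration
  -- d ↦ d (2 - c d) lifts an inverse modulo p to a compatible system of
  -- inverses modulo p^(j+1).
  module UnitInverse (c : ℤ) (p∤c : ¬ ((+ p) ∣ c)) where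
    d : ℕ → ℤ
    d zero = proj₁ (inverse c p∤c)
    d (suc j) = d j * (+ 2 - c * d j)

    d-inverse : ∀ j → ModEq (p ℕ.^ suc j) (c * d j) (+ 1)
    d-inverse zero = modEq-weaken (ℕD.∣-reflexive (ℕP.*-identityʳ p)) (proj₂ (inverse c p∤c))
    d-inverse (suc j) =
      modEq-trans (modEq-reflexive (lem c (d j)))
        (modEq-+ (modEq-neg (modEq-weaken (sq j) (modEq-zero-* small small))) (modEq-refl {a = + 1}))
      where
      small : ModEq (p ℕ.^ suc j) (c * d j + - (+ 1)) (+ 0)
      small = modEq-+ (d-inverse j) (modEq-refl {a = - (+ 1)})
      -- 1 - c d′ = (1 - c d)²
      lem : ∀ c d → c * (d * (+ 2 - c * d)) ≡ - ((c * d + - (+ 1)) * (c * d + - (+ 1))) + + 1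
      lem = solve-∀
      sq : ∀ j → (p ℕ.^ suc (suc j)) ℕD.∣ ((p ℕ.^ suc j) ℕ.* (p ℕ.^ suc j))
      sq j = ℕD.divides (p ℕ.^ j) (lemℕ p (p ℕ.^ j))
        where lemℕ : ∀ p x → (p ℕ.* x) ℕ.* (p ℕ.* x) ≡ x ℕ.* (p ℕ.* (p ℕ.* x))
              lemℕ = ℕSolver.solve-∀

    d-step : ∀ j → ModEq (p ℕ.^ suc j) (d (suc j)) (d j)
    d-step j =
      modEq-trans (modEq-reflexive (lem c (d j)))
        (modEq-trans (modEq-+ (modEq-refl {a = d j})
                              (modEq-trans (modEq-* (modEq-refl {a = d j}) (modEq-neg (modEq-+ (d-inverse j) (modEq-refl {a = - (+ 1)}))))
                                           (modEq-reflexive (ℤP.*-zeroʳ (d j)))))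
                     (modEq-reflexive (ℤP.+-identityʳ (d j))))
      where
      lem : ∀ c d → d * (+ 2 - c * d) ≡ d + d * (- (c * d + - (+ 1)))
      lem = solve-∀

    isUnit : IsUnitZp p (λ _ → c)
    isUnit = d , (λ j → toCong (modEq-weaken (ℕD.divides p refl) (d-step j)))
               , (λ j → toCong (modEq-weaken (ℕD.divides p refl) (d-inverse j)))


-- The order ℜ = ℤ[φ] ⊕ ℤ[φ]Π: its matrices, the embedding of ℤ[φ]-matrices
-- (a ↦ a + 0Π, a ring homomorphism) and the reduction a + bΠ ↦ a, which is
-- multiplicative modulo p because Π² = p.
module QuaternionMatrices (p : ℕ) (α : ℤ) where

  open import Defs
  open QuadraticOrder
  open MatricesModulo α using (module M)
  open MatrixShapes using (diagM-map; blockDiag-map; blockDiag-ext)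
  open import Data.Nat as ℕ using (zero; suc)
  open import Data.Fin using (Fin; zero; suc)
  open import Data.Integer using (+_; _+_; _*_; -_; _-_)
  open import Data.Integer.Divisibility.Signed using (divides)
  open import Data.Integer.Tactic.RingSolver using (solve-∀)
  open import Data.Product using (_,_)
  open import Relation.Binary.PropositionalEquality using (_≡_; refl; sym; trans; cong; cong₂)

  record ModEqQ (m : ℕ) (x y : Quat) : Set where
    constructor _,q_
    field
      qa-modEq : ModEqφ m (qa x) (qa y)
      qb-modEq : ModEqφ m (qb x) (qb y)

  toCongQ : ∀ {m x y} → ModEqQ m x y → CongQ m x y
  toCongQ (a ,q b) = toCongZφ a , toCongZφ b

  modEqQ-reflexive : ∀ {m x y} → x ≡ y → ModEqQ m x y
  modEqQ-reflexive refl = modEqφ-reflexive refl ,q modEqφ-reflexive refl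
  modEqQ-trans : ∀ {m x y z} → ModEqQ m x y → ModEqQ m y z → ModEqQ m x z
  modEqQ-trans (a ,q b) (c ,q d) = modEqφ-trans a c ,q modEqφ-trans b d
  modEqQ-sym : ∀ {m x y} → ModEqQ m x y → ModEqQ m y x
  modEqQ-sym (a ,q b) = modEqφ-sym a ,q modEqφ-sym b

  emb : Zφ → Quat
  emb a = a +Π zeroφ

  embM : ∀ {n} → Mat n Zφ → Mat n Quat
  embM X i j = emb (X i j)

  qaM : ∀ {n} → Mat n Quat → Mat n Zφ
  qaM X i j = qa (X i j)

  embM-cong : ∀ {n} {m} {X Y : Mat n Zφ} → M._≋_ m X Y → ∀ i j → ModEqQ m (embM X i j) (embM Y i j)
  embM-cong h i j = h i j ,q modEqφ-reflexive refl

  emb-sc : ∀ {n} (x : Zφ) i j → scalarMat zeroQ (emb x) {n} i j ≡ embM (scalarMat zeroφ x) i j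
  emb-sc x i j = sym (diagM-map emb zeroφ x (λ _ → x) i j)

  qa-sc : ∀ {n} (z : Quat) i j → qa (scalarMat zeroQ z {n} i j) ≡ scalarMat zeroφ (qa z) i j
  qa-sc z i j = diagM-map qa zeroQ z (λ _ → z) i j

  QMul-ext : ∀ {n} {X X′ Y Y′ : Mat n Quat} → (∀ i j → X i j ≡ X′ i j) → (∀ i j → Y i j ≡ Y′ i j)
    → ∀ i j → QMul p α X Y i j ≡ QMul p α X′ Y′ i j
  QMul-ext hX hY i j = sumFin-ext (λ k → cong₂ (mulQ p α) (hX i k) (hY k j))
    where
    sumFin-ext : ∀ {n} {f g : Fin n → Quat} → (∀ k → f k ≡ g k) → sumFin (addQ p α) zeroQ f ≡ sumFin (addQ p α) zeroQ g
    sumFin-ext {zero} h = refl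
    sumFin-ext {suc n} h = cong₂ (addQ p α) (h zero) (sumFin-ext (λ k → h (suc k)))

  qa-Σ : ∀ {n} (f : Fin n → Quat) → qa (sumFin (addQ p α) zeroQ f) ≡ sumFin (addφ α) zeroφ (λ k → qa (f k))
  qa-Σ {zero} f = refl
  qa-Σ {suc n} f = cong (addφ α (qa (f zero))) (qa-Σ (λ k → f (suc k)))
  qb-Σ : ∀ {n} (f : Fin n → Quat) → qb (sumFin (addQ p α) zeroQ f) ≡ sumFin (addφ α) zeroφ (λ k → qb (f k))
  qb-Σ {zero} f = refl
  qb-Σ {suc n} f = cong (addφ α (qb (f zero))) (qb-Σ (λ k → f (suc k)))

  private
    mul0ˡ : ∀ x → mulφ α zeroφ x ≡ zeroφ
    mul0ˡ (x0 +φ x1) = cong₂ _+φ_ (l0 α x0 x1) (l1 x0 x1)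
      where l0 : ∀ a x0 x1 → + 0 * x0 + a * (+ 0 * x1) ≡ + 0
            l0 = solve-∀
            l1 : ∀ x0 x1 → + 0 * x1 + + 0 * x0 ≡ + 0
            l1 = solve-∀
    mul0ʳ : ∀ x → mulφ α x zeroφ ≡ zeroφ
    mul0ʳ x = trans (OrderLaws.⊗-comm α x zeroφ) (mul0ˡ x)
    add0ʳ : ∀ x → addφ α x zeroφ ≡ x
    add0ʳ = OrderLaws.⊕-identityʳ α

  qa-emb-mul : ∀ a b → qa (mulQ p α (emb a) (emb b)) ≡ mulφ α a b
  qa-emb-mul a b = trans (cong (λ z → addφ α (mulφ α a b) (mulφ α (scalφ (+ p)) z)) (mul0ˡ (conjφ zeroφ)))
                         (trans (cong (addφ α (mulφ α a b)) (mul0ʳ (scalφ (+ p)))) (add0ʳ _))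
  qb-emb-mul : ∀ a b → qb (mulQ p α (emb a) (emb b)) ≡ zeroφ
  qb-emb-mul a b = trans (cong₂ (addφ α) (mul0ʳ a) (mul0ˡ (conjφ b))) (add0ʳ zeroφ)

  QMul-embM : ∀ {n} (m : ℕ) (U V : Mat n Zφ) i j
    → ModEqQ m (QMul p α (embM U) (embM V) i j) (embM (M._·_ m U V) i j)
  QMul-embM m U V i j =
    modEqφ-trans (modEqφ-reflexive (qa-Σ (λ k → mulQ p α (emb (U i k)) (emb (V k j)))))
                 (M.Σ-cong m (λ k → modEqφ-reflexive (qa-emb-mul (U i k) (V k j))))
    ,q modEqφ-trans (modEqφ-reflexive (qb-Σ (λ k → mulQ p α (emb (U i k)) (emb (V k j)))))
                    (M.Σ-zero m (λ k → modEqφ-reflexive (qb-emb-mul (U i k) (V k j))))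

  embM-·-sc : ∀ {n} {m} (U V : Mat n Zφ) z → M._≋_ m (M._·_ m U V) (M.sc m z)
    → MatCong CongQ m (QMul p α (embM U) (embM V)) (scalarMat zeroQ (emb z))
  embM-·-sc {m = m} U V z h i j =
    toCongQ (modEqQ-trans (QMul-embM m U V i j) (modEqQ-trans (embM-cong h i j) (modEqQ-reflexive (sym (emb-sc z i j)))))

  p*≡0 : ∀ z → ModEqφ p (mulφ α (scalφ (+ p)) z) zeroφ
  p*≡0 (z0 +φ z1) = modEq (divides z0 (l0 α (+ p) z0 z1)) ,φ modEq (divides z1 (l1 (+ p) z1 z0))
    where
    open IntegerCongruence using (modEq)
    l0 : ∀ a p z0 z1 → p * z0 + a * (+ 0 * z1) - + 0 ≡ z0 * p
    l0 = solve-∀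
    l1 : ∀ p z1 z0 → p * z1 + + 0 * z0 - + 0 ≡ z1 * p
    l1 = solve-∀

  -- reduction modulo Π is multiplicative: (a + bΠ)(c + dΠ) = (ac + p b d̄) + …
  qa-mul : ∀ x y → ModEqφ p (qa (mulQ p α x y)) (mulφ α (qa x) (qa y))
  qa-mul x y = modEqφ-trans (addφ-cong α (modEqφ-reflexive {x = mulφ α (qa x) (qa y)} refl) (p*≡0 (mulφ α (qb x) (conjφ (qb y)))))
                            (modEqφ-reflexive (add0ʳ _))

  qaM-QMul : ∀ {n} (X Y : Mat n Quat) i j → ModEqφ p (qa (QMul p α X Y i j)) (M._·_ p (qaM X) (qaM Y) i j)
  qaM-QMul X Y i j = modEqφ-trans (modEqφ-reflexive (qa-Σ (λ k → mulQ p α (X i k) (Y k j))))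
                                  (M.Σ-cong p (λ k → qa-mul (X i k) (Y k j)))

  -φ φ : Zφ
  -φ = (+ 0) +φ (- (+ 1))
  φ = (+ 0) +φ (+ 1)

  D± : ∀ r s → Mat (r ℕ.+ s) Zφ
  D± r s = blockDiag zeroφ r s (scalarMat zeroφ -φ) (scalarMat zeroφ φ)

  Φ≡embM : ∀ r s i j → Φ p α r s i j ≡ embM (D± r s) i j
  Φ≡embM r s i j = trans (blockDiag-ext zeroQ r s (emb-sc -φ) (emb-sc φ) i j)
                         (sym (blockDiag-map emb zeroφ r s (scalarMat zeroφ -φ) (scalarMat zeroφ φ) i j))

  qaM-Φ : ∀ r s i j → qa (Φ p α r s i j) ≡ D± r s i j
  qaM-Φ r s i j = cong qa (Φ≡embM r s i j)


-- Since p is odd and α is a unit mod p, φ is not a zero divisor and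
-- φ ≢ -φ modulo p: an element e with e φ ≡ -φ e (mod p) vanishes mod p.
module AntiCommutation {p : ℕ} (isPrime : Prime p) (p≢2 : p ≢ 2) (α : ℤ) (p∤α : ¬ ((+ p) ∣ α)) where

  open import Defs
  open IntegerCongruence
  open QuadraticOrder
  open ResiduesModPrime isPrime using (euclid; p∤2)
  open QuaternionMatrices p α using (-φ; φ)
  open import Data.Integer using (+_; _+_; _*_; -_; _-_)
  import Data.Integer.Properties as ℤP
  open import Data.Integer.Tactic.RingSolver using (solve-∀)
  open import Data.Sum using (inj₁; inj₂)
  open import Data.Empty using (⊥-elim)
  open import Relation.Binary.PropositionalEquality using (_≡_; subst)
  import Data.Nat.Divisibility as ℕD

  private
    cancel-2 : ∀ y → (+ p) ∣ (+ 2 * y) → (+ p) ∣ y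
    cancel-2 y h with euclid (+ 2) y h
    ... | inj₁ p∣2 = ⊥-elim (p∤2 p≢2 p∣2)
    ... | inj₂ p∣y = p∣y

    cancel-2α : ∀ y → (+ p) ∣ (+ 2 * (α * y)) → (+ p) ∣ y
    cancel-2α y h with euclid α y (cancel-2 (α * y) h)
    ... | inj₁ p∣α = ⊥-elim (p∤α p∣α)
    ... | inj₂ p∣y = p∣y

    cancel-neg : ∀ z → (+ p) ∣ (- z) → (+ p) ∣ z
    cancel-neg z = subst (p ℕD.∣_) (ℤP.∣-i∣≡∣i∣ z)

  -- e φ - (-φ) e = 2 φ e, whose coordinates are 2 α e₁ and 2 e₀
  anticommutes⇒≡0 : ∀ e → ModEqφ p (mulφ α e φ) (mulφ α -φ e) → ModEqφ p e zeroφ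
  anticommutes⇒≡0 (e0 +φ e1) (h0 ,φ h1) =
    ∣⇒≡0 (cancel-2 e0 (modEq⇒∣ h1 (l1 e0 e1))) ,φ ∣⇒≡0 (cancel-2α e1 (modEq⇒∣ h0 (l0 α e0 e1)))
    where
    l0 : ∀ a u0 u1 → (u0 * + 0 + a * (u1 * + 1)) - (+ 0 * u0 + a * (- (+ 1) * u1)) ≡ + 2 * (a * u1)
    l0 = solve-∀
    l1 : ∀ u0 u1 → (u0 * + 1 + u1 * + 0) - (+ 0 * u1 + - (+ 1) * u0) ≡ + 2 * u0
    l1 = solve-∀

  anticommutes′⇒≡0 : ∀ e → ModEqφ p (mulφ α e -φ) (mulφ α φ e) → ModEqφ p e zeroφ
  anticommutes′⇒≡0 (e0 +φ e1) (h0 ,φ h1) =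
    ∣⇒≡0 (cancel-2 e0 (cancel-neg (+ 2 * e0) (modEq⇒∣ h1 (l1 e0 e1))))
    ,φ ∣⇒≡0 (cancel-2α e1 (cancel-neg (+ 2 * (α * e1)) (modEq⇒∣ h0 (l0 α e0 e1))))
    where
    l0 : ∀ a u0 u1 → (u0 * + 0 + a * (u1 * - (+ 1))) - (+ 0 * u0 + a * (+ 1 * u1)) ≡ - (+ 2 * (a * u1))
    l0 = solve-∀
    l1 : ∀ u0 u1 → (u0 * - (+ 1) + u1 * + 0) - (+ 0 * u1 + + 1 * u0) ≡ - (+ 2 * u0)
    l1 = solve-∀


-- Reducing the defining
-- identities of X ∈ J(ℤ_p) modulo p shows that A = π X is invertible, A* A = c
-- and A commutes with diag(-φ, φ); the latter forces A to be block diagonal,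
-- and the blocks inherit invertibility and unitarity.
module Image {p : ℕ} (isPrime : Prime p) (p≢2 : p ≢ 2) (α : ℤ) (p∤α : ¬ ((+ p) ∣ α)) (r s : ℕ) where

  open import Defs
  open QuadraticOrder
  open MatricesModulo α
  open QuaternionMatrices p α
  open AntiCommutation isPrime p≢2 α p∤α
  open MatrixLifting α p using (p∣p^1)
  open ResiduesModPrime isPrime using (unit⇒p∤)
  open IntegerCongruence using (fromCong; modEq-weaken)
  open import Data.Nat as ℕ using ()
  open import Data.Product using (_,_; proj₁)
  open import Relation.Binary.PropositionalEquality using (sym)

  module R = M p
  module B = R.Blocks r s

  reduce : ∀ x y → CongQ (p ℕ.^ 1) x y → ModEqφ p (qa x) (qa y)
  reduce x y h = modEqφ-weaken p∣p^1 (fromCongZφ (proj₁ h))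

  reduce-· : ∀ {n} (X Y Z : Mat n Quat) → MatCong CongQ (p ℕ.^ 1) (QMul p α X Y) Z → qaM X · qaM Y ≋[ p ] qaM Z
  reduce-· X Y Z h i j = modEqφ-trans (modEqφ-sym (qaM-QMul X Y i j)) (reduce (QMul p α X Y i j) (Z i j) (h i j))

  reduce-sc : ∀ {n} (z : Quat) → qaM (scalarMat zeroQ z {n}) ≋[ p ] sc (qa z)
  reduce-sc z i j = modEqφ-reflexive (qa-sc z i j)

  module Reduction (X Y : Mat (r ℕ.+ s) Quat) (c : ℤ) (p∤c : ¬ ((+ p) ∣ c))
      (XY≡I : MatCong CongQ (p ℕ.^ 1) (QMul p α X Y) (QI p α))
      (YX≡I : MatCong CongQ (p ℕ.^ 1) (QMul p α Y X) (QI p α))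
      (X*X≡c : MatCong CongQ (p ℕ.^ 1) (QMul p α (conjT conjQ X) X) (scalarMat zeroQ (scalQ c)))
      (XΦ≡ΦX : MatCong CongQ (p ℕ.^ 1) (QMul p α X (Φ p α r s)) (QMul p α (Φ p α r s) X)) where

    A Ā : Mat (r ℕ.+ s) Zφ
    A = qaM X
    Ā = qaM Y

    AĀ≋I : A · Ā ≋[ p ] I
    AĀ≋I = R.≋-trans (reduce-· X Y (QI p α) XY≡I) (reduce-sc oneQ)
    ĀA≋I : Ā · A ≋[ p ] I
    ĀA≋I = R.≋-trans (reduce-· Y X (QI p α) YX≡I) (reduce-sc oneQ)
    A*A≋c : A ᴴ · A ≋[ p ] sc (scalφ c)
    A*A≋c = R.≋-trans (reduce-· (conjT conjQ X) X _ X*X≡c) (reduce-sc (scalQ c))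

    AD≋DA : A · B.D -φ φ ≋[ p ] B.D -φ φ · A
    AD≋DA = R.≋-trans (R.·-congˡ A (λ i j → modEqφ-reflexive (sym (qaM-Φ r s i j))))
           (R.≋-trans (reduce-· X (Φ p α r s) _ XΦ≡ΦX)
           (R.≋-trans (λ i j → qaM-QMul (Φ p α r s) X i j)
                      (R.·-congʳ A (λ i j → modEqφ-reflexive (qaM-Φ r s i j)))))

    A-blockDiagonal : B.IsBlockDiagonal A
    A-blockDiagonal = record
      { upper = λ a b → anticommutes⇒≡0 _ (B.commutes-D-upper -φ φ A AD≋DA a b)
      ; lower = λ a b → anticommutes′⇒≡0 _ (B.commutes-D-lower -φ φ A AD≋DA a b) }

    private
      restrictˡ : ∀ {P : Mat (r ℕ.+ s) Zφ} {Q : Mat r Zφ} t → P ≋[ p ] sc t → R._≋_ (B.topLeft P) Q → Q ≋[ p ] sc t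
      restrictˡ t h e = R.≋-trans (R.≋-sym e) (R.≋-trans (λ a b → h _ _) (B.topLeft-sc t))
      restrictʳ : ∀ {P : Mat (r ℕ.+ s) Zφ} {Q : Mat s Zφ} t → P ≋[ p ] sc t → R._≋_ (B.bottomRight P) Q → Q ≋[ p ] sc t
      restrictʳ t h e = R.≋-trans (R.≋-sym e) (R.≋-trans (λ a b → h _ _) (B.bottomRight-sc t))

    inG : InG p α r s A
    inG = B.topLeft A , B.bottomRight A , c
        , (B.topLeft Ā , toMatCong (restrictˡ oneφ AĀ≋I (B.topLeft-·ˡ Ā A-blockDiagonal))
                       , toMatCong (restrictˡ oneφ ĀA≋I (B.topLeft-·ʳ Ā A-blockDiagonal)))
        , (B.bottomRight Ā , toMatCong (restrictʳ oneφ AĀ≋I (B.bottomRight-·ˡ Ā A-blockDiagonal))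
                           , toMatCong (restrictʳ oneφ ĀA≋I (B.bottomRight-·ʳ Ā A-blockDiagonal)))
        , p∤c
        , toMatCong (restrictˡ (scalφ c) A*A≋c (B.topLeft-·ʳ (A ᴴ) A-blockDiagonal))
        , toMatCong (restrictʳ (scalφ c) A*A≋c (B.bottomRight-·ʳ (A ᴴ) A-blockDiagonal))
        , toMatCong (B.IsBlockDiagonal⇒≋bd A-blockDiagonal)

  image : (X : ℕ → Mat (r ℕ.+ s) Quat) → InJ p α r s X → InG p α r s (π X)
  image X ((_ , Y , _ , XY≡I , YX≡I) , (c , _ , (d , _ , cd≡1) , X*X≡c) , XΦ≡ΦX) =
    Reduction.inG (X 1) (Y 1) (c 1) p∤c (XY≡I 1) (YX≡I 1) (X*X≡c 1) (XΦ≡ΦX 1)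
    where p∤c = unit⇒p∤ (c 1) (d 1) (modEq-weaken p∣p^1 (fromCong (cd≡1 1)))


-- The blocks are lifted separately by Hensel's lemma (with ε an
-- inverse of 2c modulo p), reassembled block-diagonally and embedded in ℜ;
-- block-diagonal ℤ[φ]-matrices commute with Φ automatically.
module Surjectivity {p : ℕ} (isPrime : Prime p) (p≢2 : p ≢ 2) (α : ℤ) (r s : ℕ) where

  open import Defs
  open IntegerCongruence
  open QuadraticOrder
  open MatricesModulo α
  open MatrixLifting α p
  open QuaternionMatrices p α
  open MatrixShapes using (blockDiag-conjT)
  open ResiduesModPrime isPrime using (inverse; p∤c+c; module UnitInverse)
  open import Data.Nat as ℕ using ()
  open import Data.Integer using (+_; _+_; _*_)
  open import Data.Integer.Tactic.RingSolver using (solve-∀)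
  open import Data.Product using (Σ; _×_; _,_; proj₁; proj₂)
  open import Relation.Binary.PropositionalEquality using (_≡_; refl; sym)

  module B (m : ℕ) = M.Blocks m r s

  module Lifted (c : ℤ) (p∤c : ¬ ((+ p) ∣ c))
      (Xr Zr : Mat r Zφ) (Xr-unitary : Xr ᴴ · Xr ≋[ p ] sc (scalφ c)) (XZr : Xr · Zr ≋[ p ] I) (ZXr : Zr · Xr ≋[ p ] I)
      (Xs Zs : Mat s Zφ) (Xs-unitary : Xs ᴴ · Xs ≋[ p ] sc (scalφ c)) (XZs : Xs · Zs ≋[ p ] I) (ZXs : Zs · Xs ≋[ p ] I) where

    -- ε = e with 2 c e ≡ 1 (mod p), which exists as p is odd and p ∤ c
    e : ℤ
    e = proj₁ (inverse (c + c) (p∤c+c p≢2 c p∤c))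

    2cε≡1 : ModEqφ p (mulφ α (addφ α (scalφ c) (scalφ c)) (scalφ e)) oneφ
    2cε≡1 = modEq-trans (modEq-reflexive (l0 α c e)) (proj₂ (inverse (c + c) (p∤c+c p≢2 c p∤c)))
            ,φ modEq-reflexive (l1 c e)
      where l0 : ∀ a c e → (c + c) * e + a * ((+ 0 + + 0) * + 0) ≡ (c + c) * e
            l0 = solve-∀
            l1 : ∀ c e → (c + c) * + 0 + (+ 0 + + 0) * e ≡ + 0
            l1 = solve-∀

    open UnitaryCorrection c e using (module Lift)
    module Lr = Lift 2cε≡1 Xr Zr Xr-unitary XZr ZXr
    module Ls = Lift 2cε≡1 Xs Zs Xs-unitary XZs ZXs

    A A⁻¹ : ℕ → Mat (r ℕ.+ s) Zφ
    A k = blockDiag zeroφ r s (Lr.A k) (Ls.A k)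
    A⁻¹ k = blockDiag zeroφ r s (Lr.Y k) (Ls.Y k)

    X Y : ℕ → Mat (r ℕ.+ s) Quat
    X k = embM (A k)
    Y k = embM (A⁻¹ k)

    X-coherent : MatRp p α (r ℕ.+ s) X
    X-coherent k i j = toCongQ (embM-cong (B.bd-cong (p^ k) (Lr.A-coherent k) (Ls.A-coherent k)) i j)
    Y-coherent : MatRp p α (r ℕ.+ s) Y
    Y-coherent k i j = toCongQ (embM-cong (B.bd-cong (p^ k) (Lr.Y-coherent k) (Ls.Y-coherent k)) i j)

    XY≡I : ∀ k → MatCong CongQ (p^ k) (QMul p α (X k) (Y k)) (QI p α)
    XY≡I k = embM-·-sc (A k) (A⁻¹ k) oneφ
      (M.≋-trans (p^ k) (B.bd-· (p^ k) (Lr.A k) (Lr.Y k) (Ls.A k) (Ls.Y k))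
      (M.≋-trans (p^ k) (B.bd-cong (p^ k) (Lr.Y-right k) (Ls.Y-right k)) (B.bd-sc (p^ k) oneφ)))
    YX≡I : ∀ k → MatCong CongQ (p^ k) (QMul p α (Y k) (X k)) (QI p α)
    YX≡I k = embM-·-sc (A⁻¹ k) (A k) oneφ
      (M.≋-trans (p^ k) (B.bd-· (p^ k) (Lr.Y k) (Lr.A k) (Ls.Y k) (Ls.A k))
      (M.≋-trans (p^ k) (B.bd-cong (p^ k) (Lr.Y-left k) (Ls.Y-left k)) (B.bd-sc (p^ k) oneφ)))

    X*X≡c : ∀ k → MatCong CongQ (p^ k) (QMul p α (conjT conjQ (X k)) (X k)) (scalarMat zeroQ (scalQ c))
    X*X≡c k = embM-·-sc (A k ᴴ) (A k) (scalφ c)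
      (M.≋-trans (p^ k) (M.·-congʳ (p^ k) (A k) (λ i j → modEqφ-reflexive (blockDiag-conjT conjφ zeroφ r s (Lr.A k) (Ls.A k) i j)))
      (M.≋-trans (p^ k) (B.bd-· (p^ k) (Lr.A k ᴴ) (Lr.A k) (Ls.A k ᴴ) (Ls.A k))
      (M.≋-trans (p^ k) (B.bd-cong (p^ k) (Lr.A-unitary k) (Ls.A-unitary k)) (B.bd-sc (p^ k) (scalφ c)))))

    XΦ≡ΦX : ∀ k → MatCong CongQ (p^ k) (QMul p α (X k) (Φ p α r s)) (QMul p α (Φ p α r s) (X k))
    XΦ≡ΦX k i j = toCongQ
      (modEqQ-trans (modEqQ-reflexive (QMul-ext {X = X k} {X′ = X k} (λ _ _ → refl) (Φ≡embM r s) i j))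
      (modEqQ-trans (QMul-embM (p^ k) (A k) (D± r s) i j)
      (modEqQ-trans (embM-cong (B.bd-·-D (p^ k) -φ φ (Lr.A k) (Ls.A k)) i j)
      (modEqQ-trans (modEqQ-sym (QMul-embM (p^ k) (D± r s) (A k) i j))
                    (modEqQ-reflexive (sym (QMul-ext {Y = X k} {Y′ = X k} (Φ≡embM r s) (λ _ _ → refl) i j)))))))

    inJ : InJ p α r s X
    inJ = (X-coherent , Y , Y-coherent , XY≡I , YX≡I)
        , ((λ _ → c) , (λ k → toCong (modEq-refl {a = c})) , UnitInverse.isUnit c p∤c , X*X≡c)
        , XΦ≡ΦX

    π-X : π X ≋[ p ] blockDiag zeroφ r s Xr Xs
    π-X = B.bd-cong p (Lr.A-mod-p 1) (Ls.A-mod-p 1)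

  lift : (N : Mat (r ℕ.+ s) Zφ) → InG p α r s N
    → Σ (ℕ → Mat (r ℕ.+ s) Quat) λ X → InJ p α r s X × MatCong CongZφ p (π X) N
  lift N (Xr , Xs , c , (Zr , XZr , ZXr) , (Zs , XZs , ZXs) , p∤c , Xr-unitary , Xs-unitary , N≡bd) =
    L.X , L.inJ , toMatCong (M.≋-trans p L.π-X (M.≋-sym p (fromMatCong N≡bd)))
    where
    module L = Lifted c p∤c Xr Zr (fromMatCong Xr-unitary) (fromMatCong XZr) (fromMatCong ZXr)
                            Xs Zs (fromMatCong Xs-unitary) (fromMatCong XZs) (fromMatCong ZXs)


open import Defs
open import Data.Integer using (_*_; _-_; _<_; ∣_∣; -_)
import Data.Integer.Properties as ℤP
import Data.Nat.Divisibility as ℕD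
open import Data.Product using (Σ; _×_; _,_)
open import Relation.Binary.PropositionalEquality using (sym; trans; cong; subst)

mainTheorem4 : (p : ℕ) → Prime p → p ≢ 2
    → (α : ℤ) → α < + 0 → (∀ (x : ℤ) → ¬ ((+ p) ∣ (x * x - α)))
    → (r s : ℕ)
    → ((X : ℕ → Mat (r Data.Nat.+ s) Quat) → InJ p α r s X → InG p α r s (π X))
    × ((M : Mat (r Data.Nat.+ s) Zφ) → InG p α r s M
         → Σ (ℕ → Mat (r Data.Nat.+ s) Quat) λ X → InJ p α r s X × MatCong CongZφ p (π X) M)
mainTheorem4 p isPrime p≢2 α _ nonResidue r s =
  Image.image isPrime p≢2 α p∤α r s , Surjectivity.lift isPrime p≢2 α r s
  where
  -- α is not ≡ 0² (mod p), so in particular p ∤ α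
  p∤α : ¬ ((+ p) ∣ α)
  p∤α p∣α = nonResidue (+ 0) (subst (p ℕD.∣_) (sym (trans (cong ∣_∣ (ℤP.+-identityˡ (- α))) (ℤP.∣-i∣≡∣i∣ α))) p∣α)
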